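{- Let $k\geq1$ and let $T\subset\mathbb{R}^{k+1}$ be the set of $(x_1,\dots,x_k,z)$ satisfying all inequalities of type $0$ and of types $1,2,3,4$ (defined below). Then the extremal points of $T$ are the points $\sigma_J(P)$ for $J\subset\{1,\dots,k\}$, where $P=(3/4,\dots,3/4,1/2)$, together with $Q=(1/2,\dots,1/2,1)$ if $k\geq 5$.
   Context: A type $0$, level $\ell$ inequality ($0\leq\ell\leq k$) is $x_{j_1}+\dots+x_{j_\ell}+z\geq\frac{1+\ell}{2}$ for pairwise distinct $j_1,\dots,j_\ell\in\{1,\dots,k\}$. A type $t$, level $\ell$ inequality ($1\leq t\leq 4$, $0\leq\ell\leq k-t$) is $x_{i_1}+\dots+x_{i_t}+2x_{j_1}+\dots+2x_{j_\ell}+2z\geq 1+\frac{3t}{4}+\ell$ for pairwise distinct indices $i_1,\dots,i_t,j_1,\dots,j_\ell\in\{1,\dots,k\}$. For $J\subset\{1,\dots,k\}$, $\sigma_J:\mathbb{R}^{k+1}\to\mathbb{R}^{k+1}$ is the affine map $(x_1,\dots,x_k,z)\mapsto(x_1^J,\dots,x_k^J,z+\sum_{j\in J}x_j-\frac{|J|}{2})$ with $x_j^J=1-x_j$ if $j\in J$ and $x_j^J=x_j$ otherwise. An extremal point of a convex set is a point that is not a nontrivial convex combination of two other points of the set.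
   Formalization: The set T consists of the points of ℚ^(k+1) rather than ℝ^(k+1) satisfying these inequalities, and extremality is tested against convex combinations of rational points with rational coefficients. -}

module Defs where

open import Data.Nat as ℕ using (ℕ; zero; suc; _≤_)
open import Data.Integer using (+_)
open import Data.Rational as ℚ using (ℚ; 0ℚ; 1ℚ; _/_)
open import Data.Fin using (Fin; zero; suc; _↑ˡ_; _↑ʳ_)
open import Data.Fin.Subset using (Subset; ∣_∣)
open import Data.Vec using (lookup)
open import Data.Bool using (Bool; true; false; if_then_else_)
open import Data.Product using (_×_; Σ; ∃; _,_; proj₁; proj₂)
open import Data.Sum using (_⊎_)
open import Relation.Binary.PropositionalEquality using (_≡_)
open import Function.Definitions using (Injective)

sumF : {n : ℕ} → (Fin n → ℚ) → ℚ
sumF {zero}  f = 0ℚ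
sumF {suc n} f = f zero ℚ.+ sumF (λ i → f (suc i))

Point : ℕ → Set
Point k = (Fin k → ℚ) × ℚ

xs : {k : ℕ} → Point k → Fin k → ℚ
xs = proj₁

zc : {k : ℕ} → Point k → ℚ
zc = proj₂

_≈ₚ_ : {k : ℕ} → Point k → Point k → Set
p ≈ₚ q = (∀ i → xs p i ≡ xs q i) × (zc p ≡ zc q)

Distinct : {n k : ℕ} → (Fin n → Fin k) → Set
Distinct f = Injective _≡_ _≡_ f

Type0 : (k ℓ : ℕ) → (Fin ℓ → Fin k) → Point k → Set
Type0 k ℓ j p = (+ (1 ℕ.+ ℓ) / 2) ℚ.≤ (sumF (λ a → xs p (j a)) ℚ.+ zc p)

-- type t, level ℓ inequality; ind enumerates i_1..i_t followed by j_1..j_ℓ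
TypeT : (k t ℓ : ℕ) → (Fin (t ℕ.+ ℓ) → Fin k) → Point k → Set
TypeT k t ℓ ind p =
  (1ℚ ℚ.+ (+ (3 ℕ.* t) / 4) ℚ.+ (+ ℓ / 1))
    ℚ.≤ (sumF (λ a → xs p (ind (a ↑ˡ ℓ)))
         ℚ.+ (+ 2 / 1) ℚ.* sumF (λ b → xs p (ind (t ↑ʳ b)))
         ℚ.+ (+ 2 / 1) ℚ.* zc p)

InT : (k : ℕ) → Point k → Set
InT k p =
  (∀ ℓ (j : Fin ℓ → Fin k) → Distinct j → Type0 k ℓ j p)
  × (∀ t ℓ (ind : Fin (t ℕ.+ ℓ) → Fin k) → 1 ≤ t → t ≤ 4 → Distinct ind → TypeT k t ℓ ind p)

combo : {k : ℕ} → ℚ → Point k → Point k → Point k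
combo c a b = (λ i → c ℚ.* xs a i ℚ.+ (1ℚ ℚ.- c) ℚ.* xs b i)
            , (c ℚ.* zc a ℚ.+ (1ℚ ℚ.- c) ℚ.* zc b)

IsExtremal : {k : ℕ} → (Point k → Set) → Point k → Set
IsExtremal {k} S p =
  S p × (∀ (a b : Point k) (c : ℚ) → S a → S b → 0ℚ ℚ.< c → c ℚ.< 1ℚ
         → p ≈ₚ combo c a b → a ≈ₚ p × b ≈ₚ p)

σ : {k : ℕ} → Subset k → Point k → Point k
σ J p = (λ i → if lookup J i then 1ℚ ℚ.- xs p i else xs p i)
      , (zc p ℚ.+ sumF (λ i → if lookup J i then xs p i else 0ℚ)
              ℚ.- (+ ∣ J ∣ / 2))

Pt : (k : ℕ) → Point k
Pt k = (λ _ → + 3 / 4) , (+ 1 / 2)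

Qt : (k : ℕ) → Point k
Qt k = (λ _ → + 1 / 2) , 1ℚ

{-# OPTIONS --safe #-}

-- Write x_i = ½ ± a_i with a_i ≥ 0 and z = ½ + u + Σ_{x_i < ½} a_i. In these coordinates T is cut
-- out by u ≥ 0 and Σ_{i ∈ I} (¼ − a_i)⁺ ≤ 2u for all sets I of one to four indices. The signs do
-- not occur, so each σ_J, which only flips signs, is an affine involution of T and preserves
-- extremality. P and, for k ≥ 5, Q are extremal because they are the only points of T at which
-- certain inequalities of types 0 and 1, respectively of type 4, are tight. Conversely, at an
-- extremal point every a_i ≤ ¼ and u ≤ ½, since otherwise moving a_i or u splits the point, and
-- u = 0 forces all a_i = ¼, i.e. the point is σ_J(P). If u > 0, scaling all deficits ¼ − a_i by
-- 1 ± m shows that some a_i vanishes; flipping the sign of that coordinate splits the point unless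
-- k ≥ 5 and u ≥ ½, and then u = ½ and moving any a_j ≠ 0 splits it, so the point is Q.

module Submission where

open import Defs
open import Data.Nat using (ℕ; _≤_)
open import Data.Fin.Subset using (Subset)
open import Data.Product using (_×_; ∃)
open import Data.Sum using (_⊎_)

import Algebra.Properties.Group as GroupProperties
open import Data.Bool using (Bool; true; false; if_then_else_; _∧_; _∨_; not; _xor_)
import Data.Bool.Properties as Boolₚ
open import Data.Empty using (⊥; ⊥-elim)
open import Data.Fin as Fin using (Fin; punchIn; _↑ˡ_; _↑ʳ_; splitAt)
import Data.Fin.Properties as Finₚ
open import Data.Fin.Subset using (∣_∣)
open import Data.Integer as ℤ using ()
import Data.Integer.Properties as ℤₚ
open import Data.Integer.Tactic.RingSolver renaming (solve-∀ to solveℤ-∀)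
open import Data.Nat as ℕ using (zero; suc; z≤n; s≤s)
import Data.Nat.Properties as ℕₚ
open import Data.Product using (_,_; proj₁; proj₂)
open import Data.Rational as ℚ using (ℚ; 0ℚ; 1ℚ; ½; _+_; _*_; _-_; -_; _/_; _⊔_; _⊓_; toℚᵘ)
import Data.Rational.Properties as ℚₚ
import Data.Rational.Unnormalised as ℚᵘ
import Data.Rational.Unnormalised.Properties as ℚᵘₚ
open import Data.Sum using (inj₁; inj₂; [_,_]′)
open import Data.Unit using (⊤; tt)
open import Data.Vec as Vec using (lookup)
import Data.Vec.Properties as VecP
open import Data.Vec.Functional using (_∷_; _++_; updateAt; foldr)
open import Data.Vec.Functional.Properties using (lookup-++ˡ; lookup-++ʳ; updateAt-updates; updateAt-minimal)
open import Function using (_∘_; const; id)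
open import Function.Definitions using (Injective)
open import Level using (0ℓ)
open import Relation.Binary using (Setoid; tri<; tri≈; tri>)
import Relation.Binary.Reasoning.Setoid as SetoidReasoning
open import Relation.Binary.PropositionalEquality
  using (_≡_; _≢_; refl; sym; trans; cong; cong₂; subst; subst₂; module ≡-Reasoning)
open import Relation.Nullary using (¬_; Dec; yes; no; does)
open import Relation.Nullary.Decidable using (dec⇒maybe)
open import Tactic.RingSolver using (solve-∀)
import Tactic.RingSolver.Core.AlmostCommutativeRing as ACR

module +-Group = GroupProperties ℚₚ.+-0-group

ℚ-ring : ACR.AlmostCommutativeRing 0ℓ 0ℓ
ℚ-ring = ACR.fromCommutativeRing ℚₚ.+-*-commutativeRing (λ x → dec⇒maybe (0ℚ ℚₚ.≟ x))

¼ ¾ 2ℚ : ℚ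
¼ = ℤ.+ 1 / 4
¾ = ℤ.+ 3 / 4
2ℚ = ℤ.+ 2 / 1

≤-by-gap : ∀ {p q} (e : ℚ) → q - p ≡ e → 0ℚ ℚ.≤ e → p ℚ.≤ q
≤-by-gap {p} {q} e refl 0≤e = subst₂ ℚ._≤_ (ℚₚ.+-identityʳ p) (lemma p q) (ℚₚ.+-monoʳ-≤ p 0≤e)
  where lemma : ∀ p q → p + (q - p) ≡ q
        lemma = solve-∀ ℚ-ring

<-by-gap : ∀ {p q} (e : ℚ) → q - p ≡ e → 0ℚ ℚ.< e → p ℚ.< q
<-by-gap {p} {q} e refl 0<e = subst₂ ℚ._<_ (ℚₚ.+-identityʳ p) (lemma p q) (ℚₚ.+-monoʳ-< p 0<e)
  where lemma : ∀ p q → p + (q - p) ≡ q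
        lemma = solve-∀ ℚ-ring

gap-nonNeg : ∀ {p q} → p ℚ.≤ q → 0ℚ ℚ.≤ q - p
gap-nonNeg {p} {q} p≤q = subst (ℚ._≤ q - p) (ℚₚ.+-inverseʳ p) (ℚₚ.+-monoˡ-≤ (- p) p≤q)

gap-pos : ∀ {p q} → p ℚ.< q → 0ℚ ℚ.< q - p
gap-pos {p} {q} p<q = subst (ℚ._< q - p) (ℚₚ.+-inverseʳ p) (ℚₚ.+-monoˡ-< (- p) p<q)

*-nonNeg : ∀ {p q} → 0ℚ ℚ.≤ p → 0ℚ ℚ.≤ q → 0ℚ ℚ.≤ p * q
*-nonNeg {p} {q} 0≤p 0≤q =
  subst (ℚ._≤ p * q) (ℚₚ.*-zeroʳ p) (ℚₚ.*-monoˡ-≤-nonNeg p {{ℚ.nonNegative 0≤p}} 0≤q)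

*-pos : ∀ {p q} → 0ℚ ℚ.< p → 0ℚ ℚ.< q → 0ℚ ℚ.< p * q
*-pos {p} {q} 0<p 0<q =
  subst (ℚ._< p * q) (ℚₚ.*-zeroˡ q) (ℚₚ.*-monoˡ-<-pos q {{ℚ.positive 0<q}} 0<p)

nonNeg-≡ : ∀ {p q} → p ≡ q → 0ℚ ℚ.≤ q → 0ℚ ℚ.≤ p
nonNeg-≡ refl 0≤q = 0≤q

pos-or-zero : ∀ {p} → 0ℚ ℚ.≤ p → 0ℚ ℚ.< p ⊎ p ≡ 0ℚ
pos-or-zero {p} 0≤p with ℚₚ.<-cmp 0ℚ p
... | tri< 0<p _ _ = inj₁ 0<p
... | tri≈ _ 0≡p _ = inj₂ (sym 0≡p)
... | tri> _ _ p<0 = ⊥-elim (ℚₚ.<-irrefl refl (ℚₚ.<-≤-trans p<0 0≤p))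

foldr-⊓-≤ : ∀ {n} c (f : Fin n → ℚ) i → foldr _⊓_ c f ℚ.≤ f i
foldr-⊓-≤ c f Fin.zero    = ℚₚ.p⊓q≤p (f Fin.zero) _
foldr-⊓-≤ c f (Fin.suc i) = ℚₚ.≤-trans (ℚₚ.p⊓q≤q (f Fin.zero) _) (foldr-⊓-≤ c (f ∘ Fin.suc) i)

foldr-⊓-≤-init : ∀ {n} c (f : Fin n → ℚ) → foldr _⊓_ c f ℚ.≤ c
foldr-⊓-≤-init {zero}  c f = ℚₚ.≤-refl
foldr-⊓-≤-init {suc n} c f = ℚₚ.≤-trans (ℚₚ.p⊓q≤q (f Fin.zero) _) (foldr-⊓-≤-init c (f ∘ Fin.suc))

foldr-⊓-pos : ∀ {n} {c} (f : Fin n → ℚ) → 0ℚ ℚ.< c → (∀ i → 0ℚ ℚ.< f i) → 0ℚ ℚ.< foldr _⊓_ c f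
foldr-⊓-pos {zero}  f 0<c 0<f = 0<c
foldr-⊓-pos {suc n} {c} f 0<c 0<f with ℚₚ.⊓-sel (f Fin.zero) (foldr _⊓_ c (f ∘ Fin.suc))
... | inj₁ ≡f0   = subst (0ℚ ℚ.<_) (sym ≡f0) (0<f Fin.zero)
... | inj₂ ≡rest = subst (0ℚ ℚ.<_) (sym ≡rest) (foldr-⊓-pos (f ∘ Fin.suc) 0<c (0<f ∘ Fin.suc))

reflection-midpoint : ∀ c x → x ≡ ½ * (x + (x - c)) + (1ℚ - ½) * c
reflection-midpoint = solve-∀ ℚ-ring

reflection-fixed : ∀ {c x} → x + (x - c) ≡ x → x ≡ c
reflection-fixed {c} {x} eq = trans (lemma c x) (trans (cong (λ y → c + (y - x)) eq) (lemma′ c x))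
  where lemma : ∀ c x → x ≡ c + (x + (x - c) - x)
        lemma = solve-∀ ℚ-ring
        lemma′ : ∀ c x → c + (x - x) ≡ c
        lemma′ = solve-∀ ℚ-ring

reflection-≥ : ∀ {c x} → c ℚ.≤ x → c ℚ.≤ x + (x - c)
reflection-≥ {c} {x} c≤x =
  ≤-by-gap ((x - c) + (x - c)) (lemma c x) (ℚₚ.+-mono-≤ (gap-nonNeg c≤x) (gap-nonNeg c≤x))
  where lemma : ∀ c x → x + (x - c) - c ≡ (x - c) + (x - c)
        lemma = solve-∀ ℚ-ring

midpoint-self : ∀ x → x ≡ ½ * x + (1ℚ - ½) * x
midpoint-self = solve-∀ ℚ-ring

½<1 : ½ ℚ.< 1ℚ
½<1 = <-by-gap ½ refl (ℚₚ.positive⁻¹ ½)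

-- The bounds in the inequalities are fractions ℤ.+ n / d; rewriting them with fromℕ
-- makes them polynomial in n, as the ring solver needs.
fromℕ : ℕ → ℚ
fromℕ zero    = 0ℚ
fromℕ (suc n) = 1ℚ + fromℕ n

fromℕ-+ : ∀ m n → fromℕ (m ℕ.+ n) ≡ fromℕ m + fromℕ n
fromℕ-+ zero    n = sym (ℚₚ.+-identityˡ (fromℕ n))
fromℕ-+ (suc m) n = trans (cong (1ℚ +_) (fromℕ-+ m n)) (sym (ℚₚ.+-assoc 1ℚ (fromℕ m) (fromℕ n)))

fromℕ-nonNeg : ∀ n → 0ℚ ℚ.≤ fromℕ n
fromℕ-nonNeg zero    = ℚₚ.≤-refl
fromℕ-nonNeg (suc n) = ℚₚ.+-mono-≤ (ℚₚ.nonNegative⁻¹ 1ℚ) (fromℕ-nonNeg n)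

fromℕ-mono-≤ : ∀ {m n} → m ≤ n → fromℕ m ℚ.≤ fromℕ n
fromℕ-mono-≤ {n = n} z≤n = fromℕ-nonNeg n
fromℕ-mono-≤ (s≤s m≤n)   = ℚₚ.+-monoʳ-≤ 1ℚ (fromℕ-mono-≤ m≤n)

/-+ : ∀ m n d → ℤ.+ (m ℕ.+ n) / suc d ≡ ℤ.+ m / suc d + ℤ.+ n / suc d
/-+ m n d = ℚₚ.toℚᵘ-injective (begin
  toℚᵘ (ℤ.+ (m ℕ.+ n) / suc d)                ≈⟨ ℚₚ.toℚᵘ-fromℚᵘ (mkℚᵘ (m ℕ.+ n)) ⟩
  mkℚᵘ (m ℕ.+ n)                              ≈⟨ ℚᵘ.*≡* cross ⟩
  mkℚᵘ m ℚᵘ.+ mkℚᵘ n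
    ≈⟨ ℚᵘₚ.+-cong (ℚₚ.toℚᵘ-fromℚᵘ (mkℚᵘ m)) (ℚₚ.toℚᵘ-fromℚᵘ (mkℚᵘ n)) ⟨
  toℚᵘ (ℤ.+ m / suc d) ℚᵘ.+ toℚᵘ (ℤ.+ n / suc d)
    ≈⟨ ℚₚ.toℚᵘ-homo-+ (ℤ.+ m / suc d) (ℤ.+ n / suc d) ⟨
  toℚᵘ (ℤ.+ m / suc d + ℤ.+ n / suc d)        ∎)
  where
  open ℚᵘₚ.≃-Reasoning
  mkℚᵘ : ℕ → ℚᵘ.ℚᵘ
  mkℚᵘ x = ℚᵘ.mkℚᵘ (ℤ.+ x) d
  distrib : ∀ a b c → (a ℤ.+ b) ℤ.* (c ℤ.* c) ≡ (a ℤ.* c ℤ.+ b ℤ.* c) ℤ.* c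
  distrib = solveℤ-∀
  cross : ℤ.+ (m ℕ.+ n) ℤ.* ℤ.+ (suc d ℕ.* suc d)
          ≡ (ℤ.+ m ℤ.* ℤ.+ suc d ℤ.+ ℤ.+ n ℤ.* ℤ.+ suc d) ℤ.* ℤ.+ suc d
  cross = trans (cong₂ ℤ._*_ (ℤₚ.pos-+ m n) (ℤₚ.pos-* (suc d) (suc d)))
                (distrib (ℤ.+ m) (ℤ.+ n) (ℤ.+ suc d))

/-fromℕ : ∀ n d → ℤ.+ n / suc d ≡ fromℕ n * (ℤ.+ 1 / suc d)
/-fromℕ zero    d = trans (ℚₚ.0/n≡0 (suc d)) (sym (ℚₚ.*-zeroˡ (ℤ.+ 1 / suc d)))
/-fromℕ (suc n) d = begin
  ℤ.+ (1 ℕ.+ n) / suc d                      ≡⟨ /-+ 1 n d ⟩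
  ℤ.+ 1 / suc d + ℤ.+ n / suc d              ≡⟨ cong (ℤ.+ 1 / suc d +_) (/-fromℕ n d) ⟩
  ℤ.+ 1 / suc d + fromℕ n * (ℤ.+ 1 / suc d)  ≡⟨ distrib (ℤ.+ 1 / suc d) (fromℕ n) ⟩
  (1ℚ + fromℕ n) * (ℤ.+ 1 / suc d)           ∎
  where
  open ≡-Reasoning
  distrib : ∀ c x → c + x * c ≡ (1ℚ + x) * c
  distrib = solve-∀ ℚ-ring

sumF-cong : ∀ {n} {f g : Fin n → ℚ} → (∀ i → f i ≡ g i) → sumF f ≡ sumF g
sumF-cong {zero}  f≗g = refl
sumF-cong {suc n} f≗g = cong₂ _+_ (f≗g Fin.zero) (sumF-cong (f≗g ∘ Fin.suc))

sumF-+ : ∀ {n} (f g : Fin n → ℚ) → sumF (λ i → f i + g i) ≡ sumF f + sumF g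
sumF-+ {zero}  f g = refl
sumF-+ {suc n} f g = trans (cong (f Fin.zero + g Fin.zero +_) (sumF-+ (f ∘ Fin.suc) (g ∘ Fin.suc)))
                           (interchange (f Fin.zero) (g Fin.zero) (sumF (f ∘ Fin.suc)) (sumF (g ∘ Fin.suc)))
  where interchange : ∀ a b c d → a + b + (c + d) ≡ a + c + (b + d)
        interchange = solve-∀ ℚ-ring

sumF-- : ∀ {n} (f g : Fin n → ℚ) → sumF (λ i → f i - g i) ≡ sumF f - sumF g
sumF-- {zero}  f g = sym (ℚₚ.+-inverseʳ 0ℚ)
sumF-- {suc n} f g = trans (cong (f Fin.zero - g Fin.zero +_) (sumF-- (f ∘ Fin.suc) (g ∘ Fin.suc)))
                           (interchange (f Fin.zero) (g Fin.zero) (sumF (f ∘ Fin.suc)) (sumF (g ∘ Fin.suc)))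
  where interchange : ∀ a b c d → a - b + (c - d) ≡ a + c - (b + d)
        interchange = solve-∀ ℚ-ring

sumF-* : ∀ {n} c (f : Fin n → ℚ) → sumF (λ i → c * f i) ≡ c * sumF f
sumF-* {zero}  c f = sym (ℚₚ.*-zeroʳ c)
sumF-* {suc n} c f = trans (cong (c * f Fin.zero +_) (sumF-* c (f ∘ Fin.suc)))
                           (sym (ℚₚ.*-distribˡ-+ c (f Fin.zero) (sumF (f ∘ Fin.suc))))

sumF-const : ∀ n c → sumF {n} (const c) ≡ fromℕ n * c
sumF-const zero    c = sym (ℚₚ.*-zeroˡ c)
sumF-const (suc n) c = trans (cong (c +_) (sumF-const n c)) (distrib c (fromℕ n))
  where distrib : ∀ c x → c + x * c ≡ (1ℚ + x) * c
        distrib = solve-∀ ℚ-ring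

sumF-zero : ∀ n → sumF {n} (const 0ℚ) ≡ 0ℚ
sumF-zero n = trans (sumF-const n 0ℚ) (ℚₚ.*-zeroʳ (fromℕ n))

sumF-mono-≤ : ∀ {n} {f g : Fin n → ℚ} → (∀ i → f i ℚ.≤ g i) → sumF f ℚ.≤ sumF g
sumF-mono-≤ {zero}  f≤g = ℚₚ.≤-refl
sumF-mono-≤ {suc n} f≤g = ℚₚ.+-mono-≤ (f≤g Fin.zero) (sumF-mono-≤ (f≤g ∘ Fin.suc))

sumF-nonNeg : ∀ {n} {f : Fin n → ℚ} → (∀ i → 0ℚ ℚ.≤ f i) → 0ℚ ℚ.≤ sumF f
sumF-nonNeg {n} {f} 0≤f = subst (ℚ._≤ sumF f) (sumF-zero n) (sumF-mono-≤ 0≤f)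

sumF-↑ : ∀ m {n} (f : Fin (m ℕ.+ n) → ℚ) → sumF f ≡ sumF (f ∘ (_↑ˡ n)) + sumF (f ∘ (m ↑ʳ_))
sumF-↑ zero    f = sym (ℚₚ.+-identityˡ (sumF f))
sumF-↑ (suc m) f = trans (cong (f Fin.zero +_) (sumF-↑ m (f ∘ Fin.suc))) (sym (ℚₚ.+-assoc (f Fin.zero) _ _))

sumF-punchIn : ∀ {n} (i : Fin (suc n)) (f : Fin (suc n) → ℚ) → sumF f ≡ f i + sumF (f ∘ punchIn i)
sumF-punchIn Fin.zero    f = refl
sumF-punchIn {suc n} (Fin.suc i) f =
  trans (cong (f Fin.zero +_) (sumF-punchIn i (f ∘ Fin.suc)))
        (swap (f Fin.zero) (f (Fin.suc i)) (sumF (f ∘ Fin.suc ∘ punchIn i)))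
  where swap : ∀ a b c → a + (b + c) ≡ b + (a + c)
        swap = solve-∀ ℚ-ring

sumF-agree-except : ∀ {n} (i : Fin n) (f g : Fin n → ℚ) → (∀ j → j ≢ i → f j ≡ g j) →
  sumF f ≡ sumF g + (f i - g i)
sumF-agree-except {suc n} i f g f≗g = begin
  sumF f                             ≡⟨ sumF-punchIn i f ⟩
  f i + sumF (f ∘ punchIn i)         ≡⟨ cong (f i +_) (sumF-cong off-i) ⟩
  f i + sumF (g ∘ punchIn i)         ≡⟨ regroup (f i) (g i) (sumF (g ∘ punchIn i)) ⟩
  g i + sumF (g ∘ punchIn i) + (f i - g i) ≡⟨ cong (_+ (f i - g i)) (sym (sumF-punchIn i g)) ⟩
  sumF g + (f i - g i)               ∎
  where
  open ≡-Reasoning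
  off-i : ∀ j → f (punchIn i j) ≡ g (punchIn i j)
  off-i j = f≗g (punchIn i j) (Finₚ.punchInᵢ≢i i j)
  regroup : ∀ x y R → x + R ≡ y + R + (x - y)
  regroup = solve-∀ ℚ-ring

sumF-δ : ∀ {n} (i : Fin n) (g : Fin n → ℚ) → sumF (λ j → if does (i Fin.≟ j) then g j else 0ℚ) ≡ g i
sumF-δ {suc n} i g = begin
  sumF δg                         ≡⟨ sumF-punchIn i δg ⟩
  δg i + sumF (δg ∘ punchIn i)    ≡⟨ cong₂ _+_ at-i (trans (sumF-cong off-i) (sumF-zero n)) ⟩
  g i + 0ℚ                        ≡⟨ ℚₚ.+-identityʳ (g i) ⟩
  g i                             ∎
  where
  open ≡-Reasoning
  δg : Fin (suc n) → ℚ
  δg j = if does (i Fin.≟ j) then g j else 0ℚ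
  at-i : δg i ≡ g i
  at-i with i Fin.≟ i
  ... | yes _   = refl
  ... | no  i≢i = ⊥-elim (i≢i refl)
  off-i : ∀ j → δg (punchIn i j) ≡ 0ℚ
  off-i j with i Fin.≟ punchIn i j
  ... | yes i≡ = ⊥-elim (Finₚ.punchInᵢ≢i i j (sym i≡))
  ... | no  _  = refl

injective-∷ : ∀ {n k} {i : Fin k} {f : Fin n → Fin k} →
  Injective _≡_ _≡_ f → (∀ r → f r ≢ i) → Injective _≡_ _≡_ (i ∷ f)
injective-∷ f-inj f≢i {Fin.zero}  {Fin.zero}  _  = refl
injective-∷ f-inj f≢i {Fin.zero}  {Fin.suc y} eq = ⊥-elim (f≢i y (sym eq))
injective-∷ f-inj f≢i {Fin.suc x} {Fin.zero}  eq = ⊥-elim (f≢i x eq)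
injective-∷ f-inj f≢i {Fin.suc x} {Fin.suc y} eq = cong Fin.suc (f-inj eq)

injective-++ : ∀ {m n k} {f : Fin m → Fin k} {g : Fin n → Fin k} →
  Injective _≡_ _≡_ f → Injective _≡_ _≡_ g → (∀ a b → f a ≢ g b) → Injective _≡_ _≡_ (f ++ g)
injective-++ {m} {n} {f = f} {g} f-inj g-inj f≢g {x} {y} eq
  with splitAt m x in x≡ | splitAt m y in y≡
... | inj₁ a | inj₁ b =
  trans (sym (Finₚ.splitAt⁻¹-↑ˡ x≡)) (trans (cong (_↑ˡ n) (f-inj eq)) (Finₚ.splitAt⁻¹-↑ˡ y≡))
... | inj₁ a | inj₂ b = ⊥-elim (f≢g a b eq)
... | inj₂ a | inj₁ b = ⊥-elim (f≢g b a (sym eq))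
... | inj₂ a | inj₂ b =
  trans (sym (Finₚ.splitAt⁻¹-↑ʳ x≡)) (trans (cong (m ↑ʳ_) (g-inj eq)) (Finₚ.splitAt⁻¹-↑ʳ y≡))

singleton-injective : ∀ {k} (i : Fin k) → Injective _≡_ _≡_ (λ (_ : Fin 1) → i)
singleton-injective i {Fin.zero} {Fin.zero} _ = refl

inImage : ∀ {n k} → (Fin n → Fin k) → Fin k → Bool
inImage {zero}  f j = false
inImage {suc n} f j = does (f Fin.zero Fin.≟ j) ∨ inImage (f ∘ Fin.suc) j

inImage-∋ : ∀ {n k} (f : Fin n → Fin k) r → inImage f (f r) ≡ true
inImage-∋ f Fin.zero with f Fin.zero Fin.≟ f Fin.zero
... | yes _ = refl
... | no f0≢f0 = ⊥-elim (f0≢f0 refl)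
inImage-∋ f (Fin.suc r) with f Fin.zero Fin.≟ f (Fin.suc r)
... | yes _ = refl
... | no  _ = inImage-∋ (f ∘ Fin.suc) r

inImage-∌ : ∀ {n k} (f : Fin n → Fin k) j → (∀ r → f r ≢ j) → inImage f j ≡ false
inImage-∌ {zero}  f j f≢j = refl
inImage-∌ {suc n} f j f≢j with f Fin.zero Fin.≟ j
... | yes f0≡j = ⊥-elim (f≢j Fin.zero f0≡j)
... | no  _    = inImage-∌ (f ∘ Fin.suc) j (f≢j ∘ Fin.suc)

sumF-image : ∀ {n k} (f : Fin n → Fin k) → Injective _≡_ _≡_ f → (g : Fin k → ℚ) →
  sumF (λ j → if inImage f j then g j else 0ℚ) ≡ sumF (g ∘ f)
sumF-image {zero}  {k} f f-inj g = sumF-zero k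
sumF-image {suc n} {k} f f-inj g = begin
  sumF (λ j → if inImage f j then g j else 0ℚ)  ≡⟨ sumF-cong split ⟩
  sumF (λ j → δ j + rest j)                     ≡⟨ sumF-+ δ rest ⟩
  sumF δ + sumF rest
    ≡⟨ cong₂ _+_ (sumF-δ (f Fin.zero) g) (sumF-image (f ∘ Fin.suc) suc-inj g) ⟩
  g (f Fin.zero) + sumF (g ∘ f ∘ Fin.suc)       ∎
  where
  open ≡-Reasoning
  suc-inj : Injective _≡_ _≡_ (f ∘ Fin.suc)
  suc-inj eq = Finₚ.suc-injective (f-inj eq)
  δ rest : Fin k → ℚ
  δ j    = if does (f Fin.zero Fin.≟ j) then g j else 0ℚ
  rest j = if inImage (f ∘ Fin.suc) j then g j else 0ℚ
  split : ∀ j → (if inImage f j then g j else 0ℚ) ≡ δ j + rest j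
  split j with f Fin.zero Fin.≟ j
  ... | no  _ = sym (ℚₚ.+-identityˡ (rest j))
  ... | yes refl rewrite inImage-∌ (f ∘ Fin.suc) (f Fin.zero) (λ r eq → Finₚ.0≢1+n (sym (f-inj eq))) =
    sym (ℚₚ.+-identityʳ (g (f Fin.zero)))

sumF-∘-injective-≤ : ∀ {n k} (f : Fin n → Fin k) → Injective _≡_ _≡_ f → (g : Fin k → ℚ) →
  (∀ j → 0ℚ ℚ.≤ g j) → sumF (g ∘ f) ℚ.≤ sumF g
sumF-∘-injective-≤ f f-inj g 0≤g =
  subst (ℚ._≤ sumF g) (sumF-image f f-inj g) (sumF-mono-≤ drop)
  where
  drop : ∀ j → (if inImage f j then g j else 0ℚ) ℚ.≤ g j
  drop j with inImage f j
  ... | true  = ℚₚ.≤-refl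
  ... | false = 0≤g j

record Enumeration {k : ℕ} (P : Fin k → Bool) : Set where
  field
    size       : ℕ
    index      : Fin size → Fin k
    injective  : Injective _≡_ _≡_ index
    index-∈    : ∀ r → P (index r) ≡ true
    sumF-index : ∀ (g : Fin k → ℚ) → sumF (g ∘ index) ≡ sumF (λ j → if P j then g j else 0ℚ)

enumerate : ∀ {k} (P : Fin k → Bool) → Enumeration P
enumerate {zero}  P = record
  { size = 0 ; index = λ () ; injective = λ {x} → ⊥-elim (Finₚ.¬Fin0 x)
  ; index-∈ = λ () ; sumF-index = λ g → refl }
enumerate {suc k} P with enumerate (P ∘ Fin.suc) | P Fin.zero in P0
... | E | true = record
  { size       = suc size
  ; index      = Fin.zero ∷ Fin.suc ∘ index
  ; injective  = injective-∷ (λ eq → injective (Finₚ.suc-injective eq)) (λ r ())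
  ; index-∈    = λ { Fin.zero → P0 ; (Fin.suc r) → index-∈ r }
  ; sumF-index = λ g → trans (cong (g Fin.zero +_) (sumF-index (g ∘ Fin.suc))) (head-term g) }
  where
  open Enumeration E
  rest : (Fin (suc k) → ℚ) → ℚ
  rest g = sumF (λ j → if P (Fin.suc j) then g (Fin.suc j) else 0ℚ)
  head-term : ∀ g → g Fin.zero + rest g ≡ (if P Fin.zero then g Fin.zero else 0ℚ) + rest g
  head-term g = cong (λ b → (if b then g Fin.zero else 0ℚ) + rest g) (sym P0)
... | E | false = record
  { size       = size
  ; index      = Fin.suc ∘ index
  ; injective  = λ eq → injective (Finₚ.suc-injective eq)
  ; index-∈    = index-∈
  ; sumF-index = λ g → trans (sumF-index (g ∘ Fin.suc)) (trans (sym (ℚₚ.+-identityˡ (rest g))) (head-term g)) }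
  where
  open Enumeration E
  rest : (Fin (suc k) → ℚ) → ℚ
  rest g = sumF (λ j → if P (Fin.suc j) then g (Fin.suc j) else 0ℚ)
  head-term : ∀ g → 0ℚ + rest g ≡ (if P Fin.zero then g Fin.zero else 0ℚ) + rest g
  head-term g = cong (λ b → (if b then g Fin.zero else 0ℚ) + rest g) (sym P0)

update-midpoint : ∀ {k} (a : Fin k → ℚ) i v⁺ v⁻ → a i ≡ ½ * v⁺ + (1ℚ - ½) * v⁻ →
  ∀ j → a j ≡ ½ * updateAt a i (const v⁺) j + (1ℚ - ½) * updateAt a i (const v⁻) j
update-midpoint a i v⁺ v⁻ mid j with j Fin.≟ i
... | yes refl rewrite updateAt-updates i {const v⁺} a | updateAt-updates i {const v⁻} a = mid
... | no  j≢i  rewrite updateAt-minimal j i {const v⁺} a j≢i | updateAt-minimal j i {const v⁻} a j≢i =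
  midpoint-self (a j)

update-nonNeg : ∀ {k} {a : Fin k → ℚ} i {v} → (∀ j → 0ℚ ℚ.≤ a j) → 0ℚ ℚ.≤ v →
  ∀ j → 0ℚ ℚ.≤ updateAt a i (const v) j
update-nonNeg {a = a} i 0≤a 0≤v j with j Fin.≟ i
... | yes refl = subst (0ℚ ℚ.≤_) (sym (updateAt-updates i a)) 0≤v
... | no  j≢i  = subst (0ℚ ℚ.≤_) (sym (updateAt-minimal j i a j≢i)) (0≤a j)

sumF-update-∌ : ∀ {t k} (f : ℚ → ℚ) (a : Fin k → ℚ) i v (I : Fin t → Fin k) → (∀ r → I r ≢ i) →
  sumF (f ∘ updateAt a i (const v) ∘ I) ≡ sumF (f ∘ a ∘ I)
sumF-update-∌ f a i v I avoid = sumF-cong (λ r → cong f (updateAt-minimal (I r) i a (avoid r)))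

sumF-update-∋ : ∀ {t k} (f : ℚ → ℚ) (a : Fin k → ℚ) i v (I : Fin t → Fin k) → Injective _≡_ _≡_ I →
  ∀ r → I r ≡ i → sumF (f ∘ updateAt a i (const v) ∘ I) ≡ sumF (f ∘ a ∘ I) + (f v - f (a i))
sumF-update-∋ {k = k} f a i v I I-inj r refl =
  trans (sumF-agree-except r (f ∘ a′ ∘ I) (f ∘ a ∘ I) unchanged)
        (cong (λ q → sumF (f ∘ a ∘ I) + (f q - f (a (I r)))) (updateAt-updates (I r) a))
  where
  a′ : Fin k → ℚ
  a′ = updateAt a (I r) (const v)
  unchanged : ∀ x → x ≢ r → f (a′ (I x)) ≡ f (a (I x))
  unchanged x x≢r = cong f (updateAt-minimal (I x) (I r) a (x≢r ∘ I-inj))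

-- Sign–magnitude coordinates

≈ₚ-refl : ∀ {k} {p : Point k} → p ≈ₚ p
≈ₚ-refl = (λ _ → refl) , refl

≈ₚ-sym : ∀ {k} {p q : Point k} → p ≈ₚ q → q ≈ₚ p
≈ₚ-sym (x≡ , z≡) = (sym ∘ x≡) , sym z≡

≈ₚ-trans : ∀ {k} {p q r : Point k} → p ≈ₚ q → q ≈ₚ r → p ≈ₚ r
≈ₚ-trans (x≡ , z≡) (x≡′ , z≡′) = (λ i → trans (x≡ i) (x≡′ i)) , trans z≡ z≡′

≈ₚ-setoid : ℕ → Setoid 0ℓ 0ℓ
≈ₚ-setoid k = record
  { Carrier       = Point k
  ; _≈_           = _≈ₚ_
  ; isEquivalence = record { refl = ≈ₚ-refl ; sym = ≈ₚ-sym ; trans = ≈ₚ-trans } }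

module ≈ₚ-Reasoning (k : ℕ) = SetoidReasoning (≈ₚ-setoid k)

signed : Bool → ℚ → ℚ
signed b q = if b then - q else q

negPart : Bool → ℚ → ℚ
negPart b q = if b then q else 0ℚ

-- x_i = ½ ± a_i, the sign being − where s_i holds, and z = ½ + u + Σ_{s_i} a_i.
point : ∀ {k} → (Fin k → Bool) → (Fin k → ℚ) → ℚ → Point k
point s a u = (λ i → ½ + signed (s i) (a i)) , (½ + u + sumF (λ i → negPart (s i) (a i)))

point-cong : ∀ {k} {s s′ : Fin k → Bool} {a a′ : Fin k → ℚ} {u u′ : ℚ} →
  (∀ i → s i ≡ s′ i) → (∀ i → a i ≡ a′ i) → u ≡ u′ → point s a u ≈ₚ point s′ a′ u′
point-cong {u = u} s≡ a≡ refl =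
  (λ i → cong₂ (λ b q → ½ + signed b q) (s≡ i) (a≡ i)) ,
  cong (½ + u +_) (sumF-cong (λ i → cong₂ negPart (s≡ i) (a≡ i)))

signed-zero : ∀ b → signed b 0ℚ ≡ 0ℚ
signed-zero true  = refl
signed-zero false = refl

negPart-zero : ∀ b → negPart b 0ℚ ≡ 0ℚ
negPart-zero true  = refl
negPart-zero false = refl

sumF-negPart-update : ∀ {k} (s : Fin k → Bool) (a : Fin k → ℚ) i b v →
  sumF (λ j → negPart (updateAt s i (const b) j) (updateAt a i (const v) j))
    ≡ sumF (λ j → negPart (s j) (a j)) + (negPart b v - negPart (s i) (a i))
sumF-negPart-update {k} s a i b v = begin
  sumF n′                       ≡⟨ sumF-agree-except i n′ n unchanged ⟩
  sumF n + (n′ i - n i)         ≡⟨ cong (λ x → sumF n + (x - n i)) updated ⟩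
  sumF n + (negPart b v - n i)  ∎
  where
  open ≡-Reasoning
  n n′ : Fin k → ℚ
  n  j = negPart (s j) (a j)
  n′ j = negPart (updateAt s i (const b) j) (updateAt a i (const v) j)
  unchanged : ∀ j → j ≢ i → n′ j ≡ n j
  unchanged j j≢i = cong₂ negPart (updateAt-minimal j i s j≢i) (updateAt-minimal j i a j≢i)
  updated : n′ i ≡ negPart b v
  updated = cong₂ negPart (updateAt-updates i s) (updateAt-updates i a)

point-zero-magnitudes : ∀ {k} (s s′ : Fin k → Bool) u → point s (const 0ℚ) u ≈ₚ point s′ (const 0ℚ) u
point-zero-magnitudes {k} s s′ u =
  (λ i → cong (½ +_) (trans (signed-zero (s i)) (sym (signed-zero (s′ i))))) ,
  cong (½ + u +_) (sumF-cong (λ i → trans (negPart-zero (s i)) (sym (negPart-zero (s′ i)))))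

signed-involutive : ∀ b q → signed b (signed b q) ≡ q
signed-involutive true  q = neg-involutive q
  where neg-involutive : ∀ q → - - q ≡ q
        neg-involutive = solve-∀ ℚ-ring
signed-involutive false q = refl

signed-as-negPart : ∀ b q → signed b q ≡ q - 2ℚ * negPart b q
signed-as-negPart true  q = lemma q
  where lemma : ∀ q → - q ≡ q - 2ℚ * q
        lemma = solve-∀ ℚ-ring
signed-as-negPart false q = lemma q
  where lemma : ∀ q → q ≡ q - 2ℚ * 0ℚ
        lemma = solve-∀ ℚ-ring

signed+negPart-nonNeg : ∀ b {q} → 0ℚ ℚ.≤ q → 0ℚ ℚ.≤ signed b q + negPart b q
signed+negPart-nonNeg true  {q} _   = ℚₚ.≤-reflexive (sym (ℚₚ.+-inverseˡ q))
signed+negPart-nonNeg false {q} 0≤q = subst (0ℚ ℚ.≤_) (sym (ℚₚ.+-identityʳ q)) 0≤q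

negPart-nonNeg : ∀ b {q} → 0ℚ ℚ.≤ q → 0ℚ ℚ.≤ negPart b q
negPart-nonNeg true  0≤q = 0≤q
negPart-nonNeg false _   = ℚₚ.≤-refl

nonNeg-opposite⇒zero : ∀ {p} → 0ℚ ℚ.≤ p → 0ℚ ℚ.≤ - p → p ≡ 0ℚ
nonNeg-opposite⇒zero {p} 0≤p 0≤-p =
  ℚₚ.≤-antisym (≤-by-gap (- p) (ℚₚ.+-identityˡ (- p)) 0≤-p) 0≤p

-- The signs need not agree where the magnitude is zero.
signed-injective : ∀ b c {p q} → 0ℚ ℚ.≤ p → 0ℚ ℚ.≤ q → signed b p ≡ signed c q →
  p ≡ q × negPart b p ≡ negPart c q
signed-injective true  true  _ _ eq = ℚₚ.neg-injective eq , ℚₚ.neg-injective eq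
signed-injective false false _ _ eq = eq , refl
signed-injective true  false {p} {q} 0≤p 0≤q -p≡q = trans p≡0 (sym q≡0) , p≡0
  where p≡0 : p ≡ 0ℚ
        p≡0 = nonNeg-opposite⇒zero 0≤p (subst (0ℚ ℚ.≤_) (sym -p≡q) 0≤q)
        q≡0 : q ≡ 0ℚ
        q≡0 = trans (sym -p≡q) (cong -_ p≡0)
signed-injective false true  {p} {q} 0≤p 0≤q p≡-q = trans p≡0 (sym q≡0) , sym q≡0
  where q≡0 : q ≡ 0ℚ
        q≡0 = nonNeg-opposite⇒zero 0≤q (subst (0ℚ ℚ.≤_) p≡-q 0≤p)
        p≡0 : p ≡ 0ℚ
        p≡0 = trans p≡-q (cong -_ q≡0)

point-injective : ∀ {k} {s t : Fin k → Bool} {a b : Fin k → ℚ} {u v : ℚ} →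
  (∀ i → 0ℚ ℚ.≤ a i) → (∀ i → 0ℚ ℚ.≤ b i) → point s a u ≈ₚ point t b v →
  (∀ i → a i ≡ b i) × u ≡ v
point-injective {s = s} {t} {a} {b} {u} {v} 0≤a 0≤b (x≡ , z≡) = proj₁ ∘ same , u≡v
  where
  same : ∀ i → a i ≡ b i × negPart (s i) (a i) ≡ negPart (t i) (b i)
  same i = signed-injective (s i) (t i) (0≤a i) (0≤b i) (+-Group.∙-cancelˡ ½ _ _ (x≡ i))
  u≡v : u ≡ v
  u≡v = +-Group.∙-cancelˡ ½ u v (+-Group.∙-cancelʳ _ _ _
          (trans z≡ (cong (½ + v +_) (sym (sumF-cong (proj₂ ∘ same))))))

isNeg : ℚ → Bool
isNeg (ℚ.mkℚ ℤ.-[1+ _ ] _ _) = true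
isNeg (ℚ.mkℚ (ℤ.+ _)   _ _) = false

signed-isNeg-nonNeg : ∀ q → 0ℚ ℚ.≤ signed (isNeg q) q
signed-isNeg-nonNeg q@(ℚ.mkℚ ℤ.-[1+ _ ] _ _) = ℚₚ.neg-antimono-≤ (ℚₚ.<⇒≤ (ℚₚ.negative⁻¹ q))
signed-isNeg-nonNeg q@(ℚ.mkℚ (ℤ.+ _)   _ _) = ℚₚ.nonNegative⁻¹ q

module _ {k : ℕ} (p : Point k) where

  signs : Fin k → Bool
  signs i = isNeg (xs p i - ½)

  magnitudes : Fin k → ℚ
  magnitudes i = signed (signs i) (xs p i - ½)

  slack : ℚ
  slack = zc p - ½ - sumF (λ i → negPart (signs i) (magnitudes i))

  magnitudes-nonNeg : ∀ i → 0ℚ ℚ.≤ magnitudes i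
  magnitudes-nonNeg i = signed-isNeg-nonNeg (xs p i - ½)

  point-coordinates : p ≈ₚ point signs magnitudes slack
  point-coordinates = (λ i → trans (recentre (xs p i)) (cong (½ +_) (sym (signed-involutive (signs i) _))))
                    , recentre′ (zc p) (sumF (λ i → negPart (signs i) (magnitudes i)))
    where
    recentre : ∀ x → x ≡ ½ + (x - ½)
    recentre = solve-∀ ℚ-ring
    recentre′ : ∀ z N → z ≡ ½ + (z - ½ - N) + N
    recentre′ = solve-∀ ℚ-ring

negPart-combo : ∀ b c x y → negPart b (c * x + (1ℚ - c) * y) ≡ c * negPart b x + (1ℚ - c) * negPart b y
negPart-combo true  c x y = refl
negPart-combo false c x y = lemma c
  where lemma : ∀ c → 0ℚ ≡ c * 0ℚ + (1ℚ - c) * 0ℚ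
        lemma = solve-∀ ℚ-ring

point-combo : ∀ {k} (s : Fin k → Bool) c {a : Fin k → ℚ} {u} (a⁺ a⁻ : Fin k → ℚ) (u⁺ u⁻ : ℚ) →
  (∀ i → a i ≡ c * a⁺ i + (1ℚ - c) * a⁻ i) → u ≡ c * u⁺ + (1ℚ - c) * u⁻ →
  point s a u ≈ₚ combo c (point s a⁺ u⁺) (point s a⁻ u⁻)
point-combo {k} s c {a} {u} a⁺ a⁻ u⁺ u⁻ a≡ u≡ = x≡ , z≡
  where
  n n⁺ n⁻ : Fin k → ℚ
  n  i = negPart (s i) (a i)
  n⁺ i = negPart (s i) (a⁺ i)
  n⁻ i = negPart (s i) (a⁻ i)
  x≡ : ∀ i → ½ + signed (s i) (a i)
             ≡ c * (½ + signed (s i) (a⁺ i)) + (1ℚ - c) * (½ + signed (s i) (a⁻ i))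
  x≡ i = trans (cong (λ q → ½ + signed (s i) q) (a≡ i)) (signed-combo (s i) (a⁺ i) (a⁻ i))
    where
    signed-combo : ∀ b x y → ½ + signed b (c * x + (1ℚ - c) * y)
                             ≡ c * (½ + signed b x) + (1ℚ - c) * (½ + signed b y)
    signed-combo true  x y = lemma c x y
      where lemma : ∀ c x y → ½ + - (c * x + (1ℚ - c) * y) ≡ c * (½ + - x) + (1ℚ - c) * (½ + - y)
            lemma = solve-∀ ℚ-ring
    signed-combo false x y = lemma c x y
      where lemma : ∀ c x y → ½ + (c * x + (1ℚ - c) * y) ≡ c * (½ + x) + (1ℚ - c) * (½ + y)
            lemma = solve-∀ ℚ-ring
  N≡ : sumF n ≡ c * sumF n⁺ + (1ℚ - c) * sumF n⁻
  N≡ = begin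
    sumF n
      ≡⟨ sumF-cong (λ i → trans (cong (negPart (s i)) (a≡ i)) (negPart-combo (s i) c (a⁺ i) (a⁻ i))) ⟩
    sumF (λ i → c * n⁺ i + (1ℚ - c) * n⁻ i)
      ≡⟨ sumF-+ (λ i → c * n⁺ i) (λ i → (1ℚ - c) * n⁻ i) ⟩
    sumF (λ i → c * n⁺ i) + sumF (λ i → (1ℚ - c) * n⁻ i)
      ≡⟨ cong₂ _+_ (sumF-* c n⁺) (sumF-* (1ℚ - c) n⁻) ⟩
    c * sumF n⁺ + (1ℚ - c) * sumF n⁻
      ∎
    where open ≡-Reasoning
  z≡ : ½ + u + sumF n ≡ c * (½ + u⁺ + sumF n⁺) + (1ℚ - c) * (½ + u⁻ + sumF n⁻)
  z≡ = trans (cong₂ (λ v N → ½ + v + N) u≡ N≡) (regroup c u⁺ u⁻ (sumF n⁺) (sumF n⁻))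
    where regroup : ∀ c u v N M → ½ + (c * u + (1ℚ - c) * v) + (c * N + (1ℚ - c) * M)
                                  ≡ c * (½ + u + N) + (1ℚ - c) * (½ + v + M)
          regroup = solve-∀ ℚ-ring

point-flip : ∀ {k} (s : Fin k → Bool) (a : Fin k → ℚ) u i δ → a i ≡ 0ℚ →
  point s a u ≈ₚ combo ½ (point (updateAt s i (const false)) (updateAt a i (const δ)) (u - ½ * δ))
                         (point (updateAt s i (const true))  (updateAt a i (const δ)) (u - ½ * δ))
point-flip {k} s a u i δ a≡0 = x≡ , z≡
  where
  s⁺ s⁻ : Fin k → Bool
  s⁺ = updateAt s i (const false)
  s⁻ = updateAt s i (const true)
  a′ : Fin k → ℚ
  a′ = updateAt a i (const δ)
  x≡ : ∀ j → ½ + signed (s j) (a j)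
             ≡ ½ * (½ + signed (s⁺ j) (a′ j)) + (1ℚ - ½) * (½ + signed (s⁻ j) (a′ j))
  x≡ j with j Fin.≟ i
  ... | yes refl rewrite updateAt-updates i {const false} s | updateAt-updates i {const true} s
                       | updateAt-updates i {const δ} a | a≡0 | signed-zero (s i) = lemma δ
    where lemma : ∀ δ → ½ + 0ℚ ≡ ½ * (½ + δ) + (1ℚ - ½) * (½ + - δ)
          lemma = solve-∀ ℚ-ring
  ... | no j≢i rewrite updateAt-minimal j i {const false} s j≢i | updateAt-minimal j i {const true} s j≢i
                     | updateAt-minimal j i {const δ} a j≢i = midpoint-self (½ + signed (s j) (a j))
  N : ℚ
  N = sumF (λ j → negPart (s j) (a j))
  n-at : negPart (s i) (a i) ≡ 0ℚ
  n-at = trans (cong (negPart (s i)) a≡0) (negPart-zero (s i))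
  N⁺≡ : sumF (λ j → negPart (s⁺ j) (a′ j)) ≡ N + (0ℚ - 0ℚ)
  N⁺≡ = trans (sumF-negPart-update s a i false δ) (cong (λ x → N + (0ℚ - x)) n-at)
  N⁻≡ : sumF (λ j → negPart (s⁻ j) (a′ j)) ≡ N + (δ - 0ℚ)
  N⁻≡ = trans (sumF-negPart-update s a i true δ) (cong (λ x → N + (δ - x)) n-at)
  z≡ : ½ + u + N ≡ ½ * (½ + (u - ½ * δ) + sumF (λ j → negPart (s⁺ j) (a′ j)))
                   + (1ℚ - ½) * (½ + (u - ½ * δ) + sumF (λ j → negPart (s⁻ j) (a′ j)))
  z≡ = trans (lemma u δ N)
             (sym (cong₂ (λ A B → ½ * (½ + (u - ½ * δ) + A) + (1ℚ - ½) * (½ + (u - ½ * δ) + B))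
                         N⁺≡ N⁻≡))
    where lemma : ∀ u δ N → ½ + u + N ≡ ½ * (½ + (u - ½ * δ) + (N + (0ℚ - 0ℚ)))
                                          + (1ℚ - ½) * (½ + (u - ½ * δ) + (N + (δ - 0ℚ)))
          lemma = solve-∀ ℚ-ring

record AffineForm (k : ℕ) : Set where
  field
    value       : Point k → ℚ
    value-cong  : ∀ {p q} → p ≈ₚ q → value p ≡ value q
    value-combo : ∀ c p q → value (combo c p q) ≡ c * value p + (1ℚ - c) * value q

open AffineForm

sumF-xs-cong : ∀ {n k} (f : Fin n → Fin k) {p q : Point k} → p ≈ₚ q → sumF (xs p ∘ f) ≡ sumF (xs q ∘ f)
sumF-xs-cong f (x≡ , _) = sumF-cong (x≡ ∘ f)

sumF-xs-combo : ∀ {n k} (f : Fin n → Fin k) c (p q : Point k) →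
  sumF (xs (combo c p q) ∘ f) ≡ c * sumF (xs p ∘ f) + (1ℚ - c) * sumF (xs q ∘ f)
sumF-xs-combo f c p q = trans (sumF-+ (λ r → c * xs p (f r)) (λ r → (1ℚ - c) * xs q (f r)))
                              (cong₂ _+_ (sumF-* c (xs p ∘ f)) (sumF-* (1ℚ - c) (xs q ∘ f)))

type0Form : ∀ {k ℓ} → (Fin ℓ → Fin k) → AffineForm k
type0Form j = record
  { value       = λ p → sumF (xs p ∘ j) + zc p
  ; value-cong  = λ p≈q → cong₂ _+_ (sumF-xs-cong j p≈q) (proj₂ p≈q)
  ; value-combo = λ c p q → trans (cong (_+ zc (combo c p q)) (sumF-xs-combo j c p q))
                                  (regroup c _ _ (zc p) (zc q)) }
  where regroup : ∀ c A B z w → c * A + (1ℚ - c) * B + (c * z + (1ℚ - c) * w)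
                              ≡ c * (A + z) + (1ℚ - c) * (B + w)
        regroup = solve-∀ ℚ-ring

typeTForm : ∀ {k} t ℓ → (Fin (t ℕ.+ ℓ) → Fin k) → AffineForm k
typeTForm {k} t ℓ ind = record
  { value       = λ p → sumF (xs p ∘ I) + 2ℚ * sumF (xs p ∘ L) + 2ℚ * zc p
  ; value-cong  = λ p≈q → cong₂ _+_ (cong₂ _+_ (sumF-xs-cong I p≈q) (cong (2ℚ *_) (sumF-xs-cong L p≈q)))
                                    (cong (2ℚ *_) (proj₂ p≈q))
  ; value-combo = λ c p q → trans (cong₂ (λ A B → A + 2ℚ * B + 2ℚ * zc (combo c p q))
                                         (sumF-xs-combo I c p q) (sumF-xs-combo L c p q))
                                  (regroup c _ _ _ _ (zc p) (zc q)) }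
  where
  I : Fin t → Fin k
  I a = ind (a ↑ˡ ℓ)
  L : Fin ℓ → Fin k
  L b = ind (t ↑ʳ b)
  regroup : ∀ c A B C D z w →
    c * A + (1ℚ - c) * B + 2ℚ * (c * C + (1ℚ - c) * D) + 2ℚ * (c * z + (1ℚ - c) * w)
                            ≡ c * (A + 2ℚ * C + 2ℚ * z) + (1ℚ - c) * (B + 2ℚ * D + 2ℚ * w)
  regroup = solve-∀ ℚ-ring

InT-resp : ∀ {k} {p q : Point k} → p ≈ₚ q → InT k p → InT k q
InT-resp p≈q (type0 , typeT) =
  (λ ℓ j j-inj → subst (_ ℚ.≤_) (value-cong (type0Form j) p≈q) (type0 ℓ j j-inj)) ,
  (λ t ℓ ind 1≤t t≤4 ind-inj →
     subst (_ ℚ.≤_) (value-cong (typeTForm t ℓ ind) p≈q) (typeT t ℓ ind 1≤t t≤4 ind-inj))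

-- Deficits and the admissibility conditions

hasDeficit : ℚ → Bool
hasDeficit q = does (q ℚₚ.<? ¼)

opaque
  deficit : ℚ → ℚ
  deficit q = 0ℚ ⊔ (¼ - q)

  deficit-of-≤¼ : ∀ {q} → q ℚ.≤ ¼ → deficit q ≡ ¼ - q
  deficit-of-≤¼ q≤¼ = ℚₚ.p≤q⇒p⊔q≡q (gap-nonNeg q≤¼)

  deficit-of-≥¼ : ∀ {q} → ¼ ℚ.≤ q → deficit q ≡ 0ℚ
  deficit-of-≥¼ {q} ¼≤q = ℚₚ.p≥q⇒p⊔q≡p (≤-by-gap {¼ - q} (q - ¼) (lemma q) (gap-nonNeg ¼≤q))
    where lemma : ∀ q → 0ℚ - (¼ - q) ≡ q - ¼
          lemma = solve-∀ ℚ-ring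

  deficit-as-if : ∀ q → deficit q ≡ (if hasDeficit q then ¼ - q else 0ℚ)
  deficit-as-if q = by-cases (q ℚₚ.<? ¼)
    where
    by-cases : (q<?¼ : Dec (q ℚ.< ¼)) → deficit q ≡ (if does q<?¼ then ¼ - q else 0ℚ)
    by-cases (yes q<¼) = deficit-of-≤¼ (ℚₚ.<⇒≤ q<¼)
    by-cases (no  q≮¼) = deficit-of-≥¼ (ℚₚ.≮⇒≥ q≮¼)

  deficit-≤¼ : ∀ {q} → 0ℚ ℚ.≤ q → deficit q ℚ.≤ ¼
  deficit-≤¼ {q} 0≤q = ℚₚ.⊔-lub (ℚₚ.nonNegative⁻¹ ¼) (≤-by-gap {¼ - q} q (lemma q) 0≤q)
    where lemma : ∀ q → ¼ - (¼ - q) ≡ q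
          lemma = solve-∀ ℚ-ring

  ¼≤+deficit : ∀ q → ¼ ℚ.≤ q + deficit q
  ¼≤+deficit q = ≤-by-gap (deficit q - (¼ - q)) (lemma q (deficit q)) (gap-nonNeg (ℚₚ.p≤q⊔p 0ℚ (¼ - q)))
    where lemma : ∀ q d → q + d - ¼ ≡ d - (¼ - q)
          lemma = solve-∀ ℚ-ring

Admissible : ∀ {k} → (Fin k → ℚ) → ℚ → Set
Admissible {k} a u =
  0ℚ ℚ.≤ u ×
  (∀ t → 1 ≤ t → t ≤ 4 → (I : Fin t → Fin k) → Injective _≡_ _≡_ I →
     sumF (deficit ∘ a ∘ I) ℚ.≤ 2ℚ * u)

admissible-of-slack-≥½ : ∀ {k} {a : Fin k → ℚ} {u} → (∀ j → 0ℚ ℚ.≤ a j) → ½ ℚ.≤ u → Admissible a u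
admissible-of-slack-≥½ {a = a} {u} 0≤a ½≤u =
  ℚₚ.≤-trans (ℚₚ.nonNegative⁻¹ ½) ½≤u , λ t _ t≤4 I _ → begin
  sumF (deficit ∘ a ∘ I)  ≤⟨ sumF-mono-≤ (deficit-≤¼ ∘ 0≤a ∘ I) ⟩
  sumF {t} (const ¼)      ≡⟨ sumF-const t ¼ ⟩
  fromℕ t * ¼             ≤⟨ ℚₚ.*-monoʳ-≤-nonNeg ¼ (fromℕ-mono-≤ t≤4) ⟩
  2ℚ * ½                  ≤⟨ ℚₚ.*-monoˡ-≤-nonNeg 2ℚ ½≤u ⟩
  2ℚ * u                  ∎
  where open ℚₚ.≤-Reasoning

Admissible-mono : ∀ {k} {a a′ : Fin k → ℚ} {u} → (∀ j → deficit (a′ j) ℚ.≤ deficit (a j)) →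
  Admissible a u → Admissible a′ u
Admissible-mono d′≤d (0≤u , bound) =
  0≤u , λ t 1≤t t≤4 I I-inj → ℚₚ.≤-trans (sumF-mono-≤ (d′≤d ∘ I)) (bound t 1≤t t≤4 I I-inj)

Admissible-scale : ∀ {k} {a a′ : Fin k → ℚ} {u} c → 0ℚ ℚ.≤ c → (∀ j → deficit (a′ j) ≡ c * deficit (a j)) →
  Admissible a u → Admissible a′ (c * u)
Admissible-scale {a = a} {u = u} c 0≤c d′≡ (0≤u , bound) =
  *-nonNeg 0≤c 0≤u , λ t 1≤t t≤4 I I-inj →
    subst₂ ℚ._≤_ (sym (trans (sumF-cong (d′≡ ∘ I)) (sumF-* c (deficit ∘ a ∘ I)))) (swap c u)
                 (ℚₚ.*-monoˡ-≤-nonNeg c {{ℚ.nonNegative 0≤c}} (bound t 1≤t t≤4 I I-inj))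
  where swap : ∀ c u → c * (2ℚ * u) ≡ 2ℚ * (c * u)
        swap = solve-∀ ℚ-ring

deficit-scale : ∀ {c q} → 0ℚ ℚ.≤ c → q ℚ.≤ ¼ → deficit (¼ - c * (¼ - q)) ≡ c * deficit q
deficit-scale {c} {q} 0≤c q≤¼ = begin
  deficit (¼ - c * (¼ - q))  ≡⟨ deficit-of-≤¼ (≤-by-gap {¼ - c * (¼ - q)} _ (lemma ¼ _) 0≤c[¼-q]) ⟩
  ¼ - (¼ - c * (¼ - q))      ≡⟨ lemma ¼ (c * (¼ - q)) ⟩
  c * (¼ - q)                ≡⟨ cong (c *_) (deficit-of-≤¼ q≤¼) ⟨
  c * deficit q              ∎
  where
  open ≡-Reasoning
  lemma : ∀ x y → x - (x - y) ≡ y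
  lemma = solve-∀ ℚ-ring
  0≤c[¼-q] : 0ℚ ℚ.≤ c * (¼ - q)
  0≤c[¼-q] = *-nonNeg 0≤c (gap-nonNeg q≤¼)

fromℕ-3* : ∀ t → fromℕ (3 ℕ.* t) ≡ fromℕ t + (fromℕ t + (fromℕ t + 0ℚ))
fromℕ-3* t = begin
  fromℕ (t ℕ.+ (t ℕ.+ (t ℕ.+ 0)))              ≡⟨ fromℕ-+ t _ ⟩
  fromℕ t + fromℕ (t ℕ.+ (t ℕ.+ 0))            ≡⟨ cong (fromℕ t +_) (fromℕ-+ t _) ⟩
  fromℕ t + (fromℕ t + fromℕ (t ℕ.+ 0))        ≡⟨ cong (λ x → fromℕ t + (fromℕ t + x)) (fromℕ-+ t 0) ⟩
  fromℕ t + (fromℕ t + (fromℕ t + 0ℚ))         ∎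
  where open ≡-Reasoning

-- The excess of each defining inequality at point s a u, as a sum of terms that
-- admissibility makes nonnegative.
module _ {k : ℕ} (s : Fin k → Bool) (a : Fin k → ℚ) (u : ℚ) where
  private
    y y⁻ : Fin k → ℚ
    y j = signed (s j) (a j)
    y⁻ j = negPart (s j) (a j)

  sumF-xs-point : ∀ {ℓ} (f : Fin ℓ → Fin k) → sumF (xs (point s a u) ∘ f) ≡ fromℕ ℓ * ½ + sumF (y ∘ f)
  sumF-xs-point {ℓ} f = trans (sumF-+ (const ½) (y ∘ f)) (cong (_+ sumF (y ∘ f)) (sumF-const ℓ ½))

  sumF-signed : ∀ {ℓ} (f : Fin ℓ → Fin k) → sumF (y ∘ f) ≡ sumF (a ∘ f) - 2ℚ * sumF (y⁻ ∘ f)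
  sumF-signed f = begin
    sumF (y ∘ f)                               ≡⟨ sumF-cong (λ r → signed-as-negPart (s (f r)) (a (f r))) ⟩
    sumF (λ r → a (f r) - 2ℚ * y⁻ (f r))       ≡⟨ sumF-- (a ∘ f) (λ r → 2ℚ * y⁻ (f r)) ⟩
    sumF (a ∘ f) - sumF (λ r → 2ℚ * y⁻ (f r))  ≡⟨ cong (λ x → sumF (a ∘ f) - x) (sumF-* 2ℚ (y⁻ ∘ f)) ⟩
    sumF (a ∘ f) - 2ℚ * sumF (y⁻ ∘ f)          ∎
    where open ≡-Reasoning

  type0-gap : ∀ {ℓ} (L : Fin ℓ → Fin k) →
    value (type0Form L) (point s a u) - ℤ.+ (1 ℕ.+ ℓ) / 2
      ≡ (sumF (y ∘ L) + sumF (y⁻ ∘ L)) + (sumF y⁻ - sumF (y⁻ ∘ L)) + u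
  type0-gap {ℓ} L =
    trans (cong₂ (λ X c → X + (½ + u + sumF y⁻) - c) (sumF-xs-point L) (/-fromℕ (suc ℓ) 1))
          (regroup (fromℕ ℓ) (sumF (y ∘ L)) (sumF (y⁻ ∘ L)) (sumF y⁻) u)
    where regroup : ∀ l Y M N u → l * ½ + Y + (½ + u + N) - (1ℚ + l) * ½ ≡ (Y + M) + (N - M) + u
          regroup = solve-∀ ℚ-ring

  typeT-gap : ∀ t ℓ (ind : Fin (t ℕ.+ ℓ) → Fin k) (I : Fin t → Fin k) (L : Fin ℓ → Fin k) →
    (∀ r → ind (r ↑ˡ ℓ) ≡ I r) → (∀ r → ind (t ↑ʳ r) ≡ L r) →
    value (typeTForm t ℓ ind) (point s a u) - (1ℚ + ℤ.+ (3 ℕ.* t) / 4 + ℤ.+ ℓ / 1)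
      ≡ (sumF (a ∘ I) - fromℕ t * ¼) + 2ℚ * u + 2ℚ * (sumF (y ∘ L) + sumF (y⁻ ∘ L))
        + 2ℚ * (sumF y⁻ - sumF (y⁻ ∘ I) - sumF (y⁻ ∘ L))
  typeT-gap t ℓ ind I L ind≗I ind≗L =
    trans (cong₂ _-_ (cong₂ (λ X Y → X + 2ℚ * Y + 2ℚ * (½ + u + sumF y⁻))
                             (trans (sumF-cong (cong (xs (point s a u)) ∘ ind≗I))
                               (trans (sumF-xs-point I) (cong (fromℕ t * ½ +_) (sumF-signed I))))
                             (trans (sumF-cong (cong (xs (point s a u)) ∘ ind≗L)) (sumF-xs-point L)))
                     (cong₂ (λ c d → 1ℚ + c + d)
                             (trans (/-fromℕ (3 ℕ.* t) 3) (cong (_* ¼) (fromℕ-3* t)))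
                             (/-fromℕ ℓ 0)))
          (regroup (fromℕ t) (fromℕ ℓ) (sumF (a ∘ I)) (sumF (y⁻ ∘ I)) (sumF (y ∘ L)) (sumF (y⁻ ∘ L))
                   (sumF y⁻) u)
    where
    regroup : ∀ t l A H Y M N u →
      t * ½ + (A - 2ℚ * H) + 2ℚ * (l * ½ + Y) + 2ℚ * (½ + u + N)
        - (1ℚ + (t + (t + (t + 0ℚ))) * ¼ + l * (ℤ.+ 1 / 1))
        ≡ (A - t * ¼) + 2ℚ * u + 2ℚ * (Y + M) + 2ℚ * (N - H - M)
    regroup = solve-∀ ℚ-ring

  negatives-cancel : ∀ {ℓ} (L : Fin ℓ → Fin k) → (∀ r → s (L r) ≡ true) →
    sumF (y ∘ L) + sumF (y⁻ ∘ L) ≡ 0ℚ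
  negatives-cancel {ℓ} L L-neg =
    trans (sym (sumF-+ (y ∘ L) (y⁻ ∘ L))) (trans (sumF-cong y+y⁻≡0) (sumF-zero ℓ))
    where y+y⁻≡0 : ∀ r → y (L r) + y⁻ (L r) ≡ 0ℚ
          y+y⁻≡0 r rewrite L-neg r = ℚₚ.+-inverseˡ (a (L r))

  type0-gap-tight : ∀ {ℓ} (L : Fin ℓ → Fin k) → (∀ r → s (L r) ≡ true) → sumF (y⁻ ∘ L) ≡ sumF y⁻ →
    value (type0Form L) (point s a u) - ℤ.+ (1 ℕ.+ ℓ) / 2 ≡ u
  type0-gap-tight L L-neg L-covers = begin
    _                                                           ≡⟨ type0-gap L ⟩
    (sumF (y ∘ L) + sumF (y⁻ ∘ L)) + (sumF y⁻ - sumF (y⁻ ∘ L)) + u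
      ≡⟨ cong₂ (λ c d → c + d + u) (negatives-cancel L L-neg)
                                   (trans (cong (λ x → sumF y⁻ - x) L-covers) (ℚₚ.+-inverseʳ (sumF y⁻))) ⟩
    0ℚ + 0ℚ + u                                                  ≡⟨ ℚₚ.+-identityˡ u ⟩
    u                                                            ∎
    where open ≡-Reasoning

  typeT-gap-tight : ∀ t ℓ (ind : Fin (t ℕ.+ ℓ) → Fin k) (I : Fin t → Fin k) (L : Fin ℓ → Fin k) →
    (∀ r → ind (r ↑ˡ ℓ) ≡ I r) → (∀ r → ind (t ↑ʳ r) ≡ L r) →
    (∀ r → s (L r) ≡ true) → sumF y⁻ ≡ sumF (y⁻ ∘ I) + sumF (y⁻ ∘ L) →
    value (typeTForm t ℓ ind) (point s a u) - (1ℚ + ℤ.+ (3 ℕ.* t) / 4 + ℤ.+ ℓ / 1)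
      ≡ 2ℚ * u - sumF (λ r → ¼ - a (I r))
  typeT-gap-tight t ℓ ind I L ind≗I ind≗L L-neg I+L-cover = begin
    _ ≡⟨ typeT-gap t ℓ ind I L ind≗I ind≗L ⟩
    (A - fromℕ t * ¼) + 2ℚ * u + 2ℚ * (sumF (y ∘ L) + M) + 2ℚ * (sumF y⁻ - H - M)
      ≡⟨ cong₂ (λ Z N → (A - fromℕ t * ¼) + 2ℚ * u + 2ℚ * Z + 2ℚ * (N - H - M))
               (negatives-cancel L L-neg) I+L-cover ⟩
    (A - fromℕ t * ¼) + 2ℚ * u + 2ℚ * 0ℚ + 2ℚ * (H + M - H - M)
      ≡⟨ regroup A (fromℕ t) u H M ⟩
    2ℚ * u - (fromℕ t * ¼ - A)
      ≡⟨ cong (λ x → 2ℚ * u - x) (sym (trans (sumF-- (const ¼) (a ∘ I)) (cong (_- A) (sumF-const t ¼)))) ⟩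
    2ℚ * u - sumF (λ r → ¼ - a (I r)) ∎
    where
    open ≡-Reasoning
    A H M : ℚ
    A = sumF (a ∘ I)
    H = sumF (y⁻ ∘ I)
    M = sumF (y⁻ ∘ L)
    regroup : ∀ A t u H M → (A - t * ¼) + 2ℚ * u + 2ℚ * 0ℚ + 2ℚ * (H + M - H - M) ≡ 2ℚ * u - (t * ¼ - A)
    regroup = solve-∀ ℚ-ring

module _ {k : ℕ} (s : Fin k → Bool) {a : Fin k → ℚ} {u : ℚ} where
  private
    y y⁻ : Fin k → ℚ
    y j = signed (s j) (a j)
    y⁻ j = negPart (s j) (a j)

  admissible⇒InT : (∀ j → 0ℚ ℚ.≤ a j) → Admissible a u → InT k (point s a u)
  admissible⇒InT 0≤a (0≤u , deficit-bound) = type0 , typeT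
    where
    y⁻-nonNeg : ∀ j → 0ℚ ℚ.≤ y⁻ j
    y⁻-nonNeg j = negPart-nonNeg (s j) (0≤a j)
    y+y⁻-nonNeg : ∀ {ℓ} (L : Fin ℓ → Fin k) → 0ℚ ℚ.≤ sumF (y ∘ L) + sumF (y⁻ ∘ L)
    y+y⁻-nonNeg L = nonNeg-≡ (sym (sumF-+ (y ∘ L) (y⁻ ∘ L)))
                            (sumF-nonNeg (λ r → signed+negPart-nonNeg (s (L r)) (0≤a (L r))))
    type0 : ∀ ℓ (L : Fin ℓ → Fin k) → Distinct L → Type0 k ℓ L (point s a u)
    type0 ℓ L L-inj = ≤-by-gap _ (type0-gap s a u L)
      (ℚₚ.+-mono-≤ (ℚₚ.+-mono-≤ (y+y⁻-nonNeg L) (gap-nonNeg (sumF-∘-injective-≤ L L-inj y⁻ y⁻-nonNeg)))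
                    0≤u)
    typeT : ∀ t ℓ (ind : Fin (t ℕ.+ ℓ) → Fin k) → 1 ≤ t → t ≤ 4 → Distinct ind →
      TypeT k t ℓ ind (point s a u)
    typeT t ℓ ind 1≤t t≤4 ind-inj = ≤-by-gap _ (typeT-gap s a u t ℓ ind I L (λ _ → refl) (λ _ → refl))
      (ℚₚ.+-mono-≤ (ℚₚ.+-mono-≤ quarters (*-nonNeg 0≤2 (y+y⁻-nonNeg L))) (*-nonNeg 0≤2 uncovered))
      where
      I : Fin t → Fin k
      I = ind ∘ (_↑ˡ ℓ)
      L : Fin ℓ → Fin k
      L = ind ∘ (t ↑ʳ_)
      I-inj : Injective _≡_ _≡_ I
      I-inj eq = Finₚ.↑ˡ-injective ℓ _ _ (ind-inj eq)
      0≤2 : 0ℚ ℚ.≤ 2ℚ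
      0≤2 = ℚₚ.nonNegative⁻¹ 2ℚ
      covered : fromℕ t * ¼ ℚ.≤ sumF (a ∘ I) + sumF (deficit ∘ a ∘ I)
      covered = subst₂ ℚ._≤_ (sumF-const t ¼) (sumF-+ (a ∘ I) (deficit ∘ a ∘ I))
                       (sumF-mono-≤ (λ r → ¼≤+deficit (a (I r))))
      regroup : ∀ A D q u → A - q + 2ℚ * u ≡ (A + D - q) + (2ℚ * u - D)
      regroup = solve-∀ ℚ-ring
      quarters : 0ℚ ℚ.≤ (sumF (a ∘ I) - fromℕ t * ¼) + 2ℚ * u
      quarters = nonNeg-≡ (regroup (sumF (a ∘ I)) (sumF (deficit ∘ a ∘ I)) (fromℕ t * ¼) u)
                          (ℚₚ.+-mono-≤ (gap-nonNeg covered) (gap-nonNeg (deficit-bound t 1≤t t≤4 I I-inj)))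
      I+L≤N : sumF (y⁻ ∘ I) + sumF (y⁻ ∘ L) ℚ.≤ sumF y⁻
      I+L≤N = subst (ℚ._≤ sumF y⁻) (sumF-↑ t (y⁻ ∘ ind)) (sumF-∘-injective-≤ ind ind-inj y⁻ y⁻-nonNeg)
      minus-+ : ∀ N H M → N - H - M ≡ N - (H + M)
      minus-+ = solve-∀ ℚ-ring
      uncovered : 0ℚ ℚ.≤ sumF y⁻ - sumF (y⁻ ∘ I) - sumF (y⁻ ∘ L)
      uncovered = nonNeg-≡ (minus-+ (sumF y⁻) _ _) (gap-nonNeg I+L≤N)

  -- Choosing the j's to be the negative coordinates makes the signed terms cancel.
  InT⇒slack-nonNeg : InT k (point s a u) → 0ℚ ℚ.≤ u
  InT⇒slack-nonNeg (type0 , _) =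
    nonNeg-≡ (sym (type0-gap-tight s a u Neg.index Neg.index-∈ covers))
             (gap-nonNeg (type0 _ Neg.index Neg.injective))
    where
    module Neg = Enumeration (enumerate s)
    covers : sumF (y⁻ ∘ Neg.index) ≡ sumF y⁻
    covers = trans (Neg.sumF-index y⁻) (sumF-cong (λ j → only-neg (s j) (a j)))
      where only-neg : ∀ b q → (if b then negPart b q else 0ℚ) ≡ negPart b q
            only-neg true  q = refl
            only-neg false q = refl

  -- Here the j's are the negative coordinates outside I.
  InT⇒quarter-bound : InT k (point s a u) → ∀ t (I : Fin (suc t) → Fin k) → Injective _≡_ _≡_ I →
    suc t ≤ 4 → sumF (λ r → ¼ - a (I r)) ℚ.≤ 2ℚ * u
  InT⇒quarter-bound (_ , typeT) t I I-inj t<4 =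
    ≤-by-gap _ (sym (typeT-gap-tight s a u (suc t) Neg.size ind I Neg.index
                                     (lookup-++ˡ I Neg.index) (lookup-++ʳ I Neg.index) s-Neg covers))
               (gap-nonNeg (typeT (suc t) Neg.size ind (s≤s z≤n) t<4 ind-inj))
    where
    module Neg = Enumeration (enumerate (λ j → s j ∧ not (inImage I j)))
    ind : Fin (suc t ℕ.+ Neg.size) → Fin k
    ind = I ++ Neg.index
    s-Neg : ∀ r → s (Neg.index r) ≡ true
    s-Neg r with s (Neg.index r) | Neg.index-∈ r
    ... | true | _ = refl
    excluded : ∀ {b c} → b ∧ not c ≡ true → c ≡ false
    excluded {true} {false} _ = refl
    I≢Neg : ∀ r r′ → I r ≢ Neg.index r′
    I≢Neg r r′ eq with trans (sym (inImage-∋ I r)) (trans (cong (inImage I) eq) (excluded (Neg.index-∈ r′)))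
    ... | ()
    ind-inj : Injective _≡_ _≡_ ind
    ind-inj = injective-++ I-inj Neg.injective I≢Neg
    split : ∀ j → y⁻ j ≡ (if inImage I j then y⁻ j else 0ℚ) + (if s j ∧ not (inImage I j) then y⁻ j else 0ℚ)
    split j with s j | inImage I j
    ... | true  | true  = sym (ℚₚ.+-identityʳ (a j))
    ... | true  | false = sym (ℚₚ.+-identityˡ (a j))
    ... | false | true  = refl
    ... | false | false = refl
    covers : sumF y⁻ ≡ sumF (y⁻ ∘ I) + sumF (y⁻ ∘ Neg.index)
    covers = trans (sumF-cong split)
                   (trans (sumF-+ (λ j → if inImage I j then y⁻ j else 0ℚ)
                                  (λ j → if s j ∧ not (inImage I j) then y⁻ j else 0ℚ))
                          (cong₂ _+_ (sumF-image I I-inj y⁻) (sym (Neg.sumF-index y⁻))))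

  InT⇒admissible : InT k (point s a u) → Admissible a u
  InT⇒admissible p∈T = 0≤u , deficit-bound
    where
    0≤u : 0ℚ ℚ.≤ u
    0≤u = InT⇒slack-nonNeg p∈T
    quarter-bound : ∀ t (I : Fin t → Fin k) → Injective _≡_ _≡_ I → t ≤ 4 →
      sumF (λ r → ¼ - a (I r)) ℚ.≤ 2ℚ * u
    quarter-bound zero    I _     _   = *-nonNeg (ℚₚ.nonNegative⁻¹ 2ℚ) 0≤u
    quarter-bound (suc t) I I-inj t<4 = InT⇒quarter-bound p∈T t I I-inj t<4
    deficit-bound : ∀ t → 1 ≤ t → t ≤ 4 → (I : Fin t → Fin k) → Injective _≡_ _≡_ I →
      sumF (deficit ∘ a ∘ I) ℚ.≤ 2ℚ * u
    deficit-bound t _ t≤4 I I-inj = subst (ℚ._≤ 2ℚ * u) (sym deficits≡)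
      (quarter-bound D.size (I ∘ D.index) (λ eq → D.injective (I-inj eq))
                     (ℕₚ.≤-trans (Finₚ.injective⇒≤ D.injective) t≤4))
      where
      module D = Enumeration (enumerate (hasDeficit ∘ a ∘ I))
      deficits≡ : sumF (deficit ∘ a ∘ I) ≡ sumF (λ r → ¼ - a (I (D.index r)))
      deficits≡ = trans (sumF-cong (deficit-as-if ∘ a ∘ I)) (sym (D.sumF-index (λ r → ¼ - a (I r))))

-- The symmetries σ_J

sumF-lookup : ∀ {k} (J : Subset k) c → sumF (λ i → if lookup J i then c else 0ℚ) ≡ fromℕ ∣ J ∣ * c
sumF-lookup Vec.[]            c = sym (ℚₚ.*-zeroˡ c)
sumF-lookup (true  Vec.∷ J) c = trans (cong (c +_) (sumF-lookup J c)) (distrib c (fromℕ ∣ J ∣))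
  where distrib : ∀ c x → c + x * c ≡ (1ℚ + x) * c
        distrib = solve-∀ ℚ-ring
sumF-lookup (false Vec.∷ J) c = trans (ℚₚ.+-identityˡ _) (sumF-lookup J c)

σ-cong : ∀ {k} (J : Subset k) {p q : Point k} → p ≈ₚ q → σ J p ≈ₚ σ J q
σ-cong J (x≡ , z≡) =
  (λ i → cong (λ x → if lookup J i then 1ℚ - x else x) (x≡ i)) ,
  cong₂ (λ z X → z + X - ℤ.+ ∣ J ∣ / 2) z≡
        (sumF-cong (λ i → cong (λ x → if lookup J i then x else 0ℚ) (x≡ i)))

σ-point : ∀ {k} (J : Subset k) (s : Fin k → Bool) (a : Fin k → ℚ) (u : ℚ) →
  σ J (point s a u) ≈ₚ point (λ i → lookup J i xor s i) a u
σ-point {k} J s a u = (λ i → reflect (lookup J i) (s i) (a i)) , z≡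
  where
  reflect : ∀ j b q → (if j then 1ℚ - (½ + signed b q) else ½ + signed b q) ≡ ½ + signed (j xor b) q
  reflect false b     q = refl
  reflect true  true  q = lemma q
    where lemma : ∀ q → 1ℚ - (½ + - q) ≡ ½ + q
          lemma = solve-∀ ℚ-ring
  reflect true  false q = lemma q
    where lemma : ∀ q → 1ℚ - (½ + q) ≡ ½ + - q
          lemma = solve-∀ ℚ-ring
  shift : ∀ j b q → (if j then ½ + signed b q else 0ℚ)
                    ≡ (if j then ½ else 0ℚ) + (negPart (j xor b) q - negPart b q)
  shift false b     q = sym (trans (ℚₚ.+-identityˡ _) (ℚₚ.+-inverseʳ (negPart b q)))
  shift true  true  q = lemma q
    where lemma : ∀ q → ½ + - q ≡ ½ + (0ℚ - q)
          lemma = solve-∀ ℚ-ring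
  shift true  false q = lemma q
    where lemma : ∀ q → ½ + q ≡ ½ + (q - 0ℚ)
          lemma = solve-∀ ℚ-ring
  n n′ : Fin k → ℚ
  n  i = negPart (s i) (a i)
  n′ i = negPart (lookup J i xor s i) (a i)
  N N′ : ℚ
  N  = sumF n
  N′ = sumF n′
  z≡ : ½ + u + N + sumF (λ i → if lookup J i then ½ + signed (s i) (a i) else 0ℚ) - ℤ.+ ∣ J ∣ / 2
       ≡ ½ + u + N′
  z≡ = begin
    ½ + u + N + sumF (λ i → if lookup J i then ½ + signed (s i) (a i) else 0ℚ) - ℤ.+ ∣ J ∣ / 2
      ≡⟨ cong₂ (λ X c → ½ + u + N + X - c)
               (trans (sumF-cong (λ i → shift (lookup J i) (s i) (a i)))
                      (trans (sumF-+ (λ i → if lookup J i then ½ else 0ℚ) (λ i → n′ i - n i))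
                             (cong₂ _+_ (sumF-lookup J ½) (sumF-- n′ n))))
               (/-fromℕ ∣ J ∣ 1) ⟩
    ½ + u + N + (fromℕ ∣ J ∣ * ½ + (N′ - N)) - fromℕ ∣ J ∣ * ½
      ≡⟨ regroup u N N′ (fromℕ ∣ J ∣ * ½) ⟩
    ½ + u + N′ ∎
    where
    open ≡-Reasoning
    regroup : ∀ u N N′ h → ½ + u + N + (h + (N′ - N)) - h ≡ ½ + u + N′
    regroup = solve-∀ ℚ-ring

σ-combo : ∀ {k} (J : Subset k) c (p q : Point k) → σ J (combo c p q) ≈ₚ combo c (σ J p) (σ J q)
σ-combo {k} J c p q = (λ i → reflect (lookup J i) (xs p i) (xs q i)) , z≡
  where
  reflect : ∀ j x y → (if j then 1ℚ - (c * x + (1ℚ - c) * y) else c * x + (1ℚ - c) * y)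
                      ≡ c * (if j then 1ℚ - x else x) + (1ℚ - c) * (if j then 1ℚ - y else y)
  reflect true  x y = lemma c x y
    where lemma : ∀ c x y → 1ℚ - (c * x + (1ℚ - c) * y) ≡ c * (1ℚ - x) + (1ℚ - c) * (1ℚ - y)
          lemma = solve-∀ ℚ-ring
  reflect false x y = refl
  restrict : ∀ j x y → (if j then c * x + (1ℚ - c) * y else 0ℚ)
                       ≡ c * (if j then x else 0ℚ) + (1ℚ - c) * (if j then y else 0ℚ)
  restrict true  x y = refl
  restrict false x y = lemma c
    where lemma : ∀ c → 0ℚ ≡ c * 0ℚ + (1ℚ - c) * 0ℚ
          lemma = solve-∀ ℚ-ring
  xp xq : Fin k → ℚ
  xp i = if lookup J i then xs p i else 0ℚ
  xq i = if lookup J i then xs q i else 0ℚ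
  Xp Xq h : ℚ
  Xp = sumF xp
  Xq = sumF xq
  h  = ℤ.+ ∣ J ∣ / 2
  z≡ : c * zc p + (1ℚ - c) * zc q + sumF (λ i → if lookup J i then c * xs p i + (1ℚ - c) * xs q i else 0ℚ) - h
         ≡ c * (zc p + Xp - h) + (1ℚ - c) * (zc q + Xq - h)
  z≡ = trans (cong (λ X → c * zc p + (1ℚ - c) * zc q + X - h)
                   (trans (sumF-cong (λ i → restrict (lookup J i) (xs p i) (xs q i)))
                          (trans (sumF-+ (λ i → c * xp i) (λ i → (1ℚ - c) * xq i))
                                 (cong₂ _+_ (sumF-* c xp) (sumF-* (1ℚ - c) xq)))))
             (regroup c (zc p) (zc q) Xp Xq h)
    where regroup : ∀ c z w X Y h → c * z + (1ℚ - c) * w + (c * X + (1ℚ - c) * Y) - h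
                                    ≡ c * (z + X - h) + (1ℚ - c) * (w + Y - h)
          regroup = solve-∀ ℚ-ring

σ-involutive : ∀ {k} (J : Subset k) (p : Point k) → σ J (σ J p) ≈ₚ p
σ-involutive {k} J p = begin
  σ J (σ J p)                              ≈⟨ σ-cong J (σ-cong J (point-coordinates p)) ⟩
  σ J (σ J (point s a u))                  ≈⟨ σ-cong J (σ-point J s a u) ⟩
  σ J (point (λ i → lookup J i xor s i) a u) ≈⟨ σ-point J _ a u ⟩
  point (λ i → lookup J i xor (lookup J i xor s i)) a u
    ≈⟨ point-cong {u = u} (λ i → cancel (lookup J i) (s i)) (λ _ → refl) refl ⟩
  point s a u                              ≈⟨ ≈ₚ-sym (point-coordinates p) ⟩
  p                                        ∎
  where
  s : Fin k → Bool
  s = signs p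
  a : Fin k → ℚ
  a = magnitudes p
  u : ℚ
  u = slack p
  cancel : ∀ j b → j xor (j xor b) ≡ b
  cancel j b = trans (sym (Boolₚ.xor-assoc j j b)) (cong (λ c → c xor b) (Boolₚ.xor-same j))
  open ≈ₚ-Reasoning k

InT-σ : ∀ {k} (J : Subset k) {p : Point k} → InT k p → InT k (σ J p)
InT-σ {k} J {p} p∈T =
  InT-resp (≈ₚ-sym σp≈) (admissible⇒InT s′ (magnitudes-nonNeg p) p-admissible)
  where s′ : Fin k → Bool
        s′ i = lookup J i xor signs p i
        p-admissible : Admissible (magnitudes p) (slack p)
        p-admissible = InT⇒admissible (signs p) (InT-resp (point-coordinates p) p∈T)
        σp≈ : σ J p ≈ₚ point s′ (magnitudes p) (slack p)
        σp≈ = ≈ₚ-trans (σ-cong J (point-coordinates p)) (σ-point J (signs p) (magnitudes p) (slack p))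

IsExtremal-resp : ∀ {k} {p q : Point k} → p ≈ₚ q → IsExtremal (InT k) p → IsExtremal (InT k) q
IsExtremal-resp p≈q (p∈T , split) =
  InT-resp p≈q p∈T ,
  λ a b c a∈T b∈T 0<c c<1 q≈ → let (a≈p , b≈p) = split a b c a∈T b∈T 0<c c<1 (≈ₚ-trans p≈q q≈)
                               in ≈ₚ-trans a≈p p≈q , ≈ₚ-trans b≈p p≈q

extremal-σ : ∀ {k} (J : Subset k) {p : Point k} → IsExtremal (InT k) p → IsExtremal (InT k) (σ J p)
extremal-σ J {p} (p∈T , split) = InT-σ J p∈T , λ a b c a∈T b∈T 0<c c<1 σp≈ →
  let p≈ = ≈ₚ-trans (≈ₚ-sym (σ-involutive J p)) (≈ₚ-trans (σ-cong J σp≈) (σ-combo J c a b))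
      (σa≈p , σb≈p) = split (σ J a) (σ J b) c (InT-σ J a∈T) (InT-σ J b∈T) 0<c c<1 p≈
  in reflect σa≈p , reflect σb≈p
  where reflect : ∀ {q} → σ J q ≈ₚ p → q ≈ₚ σ J p
        reflect {q} σq≈p = ≈ₚ-trans (≈ₚ-sym (σ-involutive J q)) (σ-cong J σq≈p)

-- Extremality from tight inequalities; P and Q

weighted-sum-zero : ∀ {c d x y} → 0ℚ ℚ.< c → 0ℚ ℚ.≤ d → 0ℚ ℚ.≤ x → 0ℚ ℚ.≤ y →
  c * x + d * y ≡ 0ℚ → x ≡ 0ℚ
weighted-sum-zero 0<c 0≤d 0≤x 0≤y eq with pos-or-zero 0≤x
... | inj₂ x≡0 = x≡0
... | inj₁ 0<x = ⊥-elim (ℚₚ.<-irrefl (sym eq) (ℚₚ.+-mono-<-≤ (*-pos 0<c 0<x) (*-nonNeg 0≤d 0≤y)))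

tight-combination : ∀ {c x y r} → 0ℚ ℚ.< c → c ℚ.< 1ℚ → r ℚ.≤ x → r ℚ.≤ y → c * x + (1ℚ - c) * y ≡ r →
  x ≡ r × y ≡ r
tight-combination {c} {x} {y} {r} 0<c c<1 r≤x r≤y eq =
  shift (weighted-sum-zero 0<c (ℚₚ.<⇒≤ (gap-pos c<1)) (gap-nonNeg r≤x) (gap-nonNeg r≤y) gaps) ,
  shift (weighted-sum-zero (gap-pos c<1) (ℚₚ.<⇒≤ 0<c) (gap-nonNeg r≤y) (gap-nonNeg r≤x)
                           (trans (ℚₚ.+-comm ((1ℚ - c) * (y - r)) (c * (x - r))) gaps))
  where
  regroup : ∀ c x y r → c * (x - r) + (1ℚ - c) * (y - r) ≡ c * x + (1ℚ - c) * y - r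
  regroup = solve-∀ ℚ-ring
  gaps : c * (x - r) + (1ℚ - c) * (y - r) ≡ 0ℚ
  gaps = trans (regroup c x y r) (trans (cong (_- r) eq) (ℚₚ.+-inverseʳ r))
  shift : ∀ {v} → v - r ≡ 0ℚ → v ≡ r
  shift {v} v-r≡0 = trans (lemma v r) (trans (cong (r +_) v-r≡0) (ℚₚ.+-identityʳ r))
    where lemma : ∀ v r → v ≡ r + (v - r)
          lemma = solve-∀ ℚ-ring

extremal-by-tight-forms : ∀ {k} {A : Set} (F : A → AffineForm k) (r : A → ℚ) {p : Point k} →
  (∀ α {q} → InT k q → r α ℚ.≤ value (F α) q) → InT k p → (∀ α → value (F α) p ≡ r α) →
  (∀ {q} → (∀ α → value (F α) q ≡ r α) → q ≈ₚ p) → IsExtremal (InT k) p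
extremal-by-tight-forms F r {p} valid p∈T p-tight unique =
  p∈T , λ a b c a∈T b∈T 0<c c<1 p≈ →
    let tight α = tight-combination 0<c c<1 (valid α a∈T) (valid α b∈T)
                    (trans (sym (value-combo (F α) c a b)) (trans (sym (value-cong (F α) p≈)) (p-tight α)))
    in unique (proj₁ ∘ tight) , unique (proj₂ ∘ tight)

Pt-point : ∀ k → Pt k ≈ₚ point (const false) (const ¼) 0ℚ
Pt-point k = (λ _ → refl) , sym (cong (½ + 0ℚ +_) (sumF-zero k))

Qt-point : ∀ k → Qt k ≈ₚ point (const false) (const 0ℚ) ½
Qt-point k = (λ _ → refl) , sym (cong (½ + ½ +_) (sumF-zero k))

-- P is the only point of T with z = ½ (type 0) and x_i + 2z = 7/4 for all i (type 1).
P-extremal : ∀ k → IsExtremal (InT k) (Pt k)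
P-extremal k = extremal-by-tight-forms F r valid P∈T (λ { (inj₁ _) → refl ; (inj₂ _) → refl }) unique
  where
  F : ⊤ ⊎ Fin k → AffineForm k
  F (inj₁ _) = type0Form {ℓ = 0} (λ ())
  F (inj₂ i) = typeTForm 1 0 (λ _ → i)
  r : ⊤ ⊎ Fin k → ℚ
  r (inj₁ _) = ℤ.+ 1 / 2
  r (inj₂ _) = 1ℚ + ℤ.+ 3 / 4 + ℤ.+ 0 / 1
  valid : ∀ α {q} → InT k q → r α ℚ.≤ value (F α) q
  valid (inj₁ _) (type0 , _) = type0 0 (λ ()) (λ { {()} })
  valid (inj₂ i) (_ , typeT) = typeT 1 0 (λ _ → i) (s≤s z≤n) (s≤s z≤n) (singleton-injective i)
  P∈T : InT k (Pt k)
  P∈T = InT-resp (≈ₚ-sym (Pt-point k)) (admissible⇒InT (const false) (λ _ → ℚₚ.nonNegative⁻¹ ¼)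
          (ℚₚ.≤-refl , λ t _ _ I _ →
             ℚₚ.≤-reflexive (trans (sumF-cong {t} (λ _ → deficit-of-≥¼ ℚₚ.≤-refl)) (sumF-zero t))))
  unique : ∀ {q} → (∀ α → value (F α) q ≡ r α) → q ≈ₚ Pt k
  unique {q} tight = x≡ , z≡
    where
    z≡ : zc q ≡ ½
    z≡ = trans (sym (ℚₚ.+-identityˡ (zc q))) (tight (inj₁ tt))
    solve-x : ∀ x z → x ≡ (x + 0ℚ + 2ℚ * 0ℚ + 2ℚ * z) - 2ℚ * z
    solve-x = solve-∀ ℚ-ring
    x≡ : ∀ i → xs q i ≡ ¾
    x≡ i = trans (solve-x (xs q i) (zc q)) (cong₂ (λ v z → v - 2ℚ * z) (tight (inj₂ i)) z≡)

Q-extremal : ∀ {k} → 5 ≤ k → IsExtremal (InT k) (Qt k)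
Q-extremal {k} (s≤s (s≤s (s≤s (s≤s (s≤s (z≤n {n})))))) =
  extremal-by-tight-forms F r valid Q∈T (λ { (inj₁ _) → refl ; (inj₂ _) → refl }) unique
  where
  others : Fin k → Fin 4 → Fin k
  others m r = punchIn m (r ↑ˡ n)
  others-injective : ∀ m → Injective _≡_ _≡_ (others m)
  others-injective m eq = Finₚ.↑ˡ-injective n _ _ (Finₚ.punchIn-injective m _ _ eq)
  F : Fin k ⊎ Fin k → AffineForm k
  F (inj₁ m) = typeTForm 4 0 (others m)
  F (inj₂ m) = typeTForm 4 1 (others m ++ const m)
  r : Fin k ⊎ Fin k → ℚ
  r (inj₁ _) = 1ℚ + ℤ.+ (3 ℕ.* 4) / 4 + ℤ.+ 0 / 1
  r (inj₂ _) = 1ℚ + ℤ.+ (3 ℕ.* 4) / 4 + ℤ.+ 1 / 1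
  valid : ∀ α {q} → InT k q → r α ℚ.≤ value (F α) q
  valid (inj₁ m) (_ , typeT) = typeT 4 0 (others m) (s≤s z≤n) ℕₚ.≤-refl (others-injective m)
  valid (inj₂ m) (_ , typeT) = typeT 4 1 (others m ++ const m) (s≤s z≤n) ℕₚ.≤-refl
    (injective-++ (others-injective m) (singleton-injective m) (λ r _ → Finₚ.punchInᵢ≢i m (r ↑ˡ n)))
  Q∈T : InT k (Qt k)
  Q∈T = InT-resp (≈ₚ-sym (Qt-point k))
          (admissible⇒InT (const false) (λ _ → ℚₚ.≤-refl)
                          (admissible-of-slack-≥½ (λ _ → ℚₚ.≤-refl) ℚₚ.≤-refl))
  -- The two forms at m differ by 2 x_m, and the first one then pins z.
  unique : ∀ {q} → (∀ α → value (F α) q ≡ r α) → q ≈ₚ Qt k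
  unique {q} tight = x≡ , z≡
    where
    solve-x : ∀ S x z → x ≡ ½ * ((S + 2ℚ * (x + 0ℚ) + 2ℚ * z) - (S + 2ℚ * 0ℚ + 2ℚ * z))
    solve-x = solve-∀ ℚ-ring
    x≡ : ∀ m → xs q m ≡ ½
    x≡ m = trans (solve-x (sumF (xs q ∘ others m)) (xs q m) (zc q))
                 (cong₂ (λ G F → ½ * (G - F)) (tight (inj₂ m)) (tight (inj₁ m)))
    solve-z : ∀ S z → z ≡ ½ * ((S + 2ℚ * 0ℚ + 2ℚ * z) - S)
    solve-z = solve-∀ ℚ-ring
    z≡ : zc q ≡ 1ℚ
    z≡ = trans (solve-z (sumF (xs q ∘ others Fin.zero)) (zc q))
               (cong₂ (λ F S → ½ * (F - S)) (tight (inj₁ Fin.zero)) (sumF-cong (x≡ ∘ others Fin.zero)))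

-- Extremal points in coordinates

-- The coordinates of the points σ_J(P) and Q.
SpecialCoordinates : ∀ {k} → (Fin k → ℚ) → ℚ → Set
SpecialCoordinates {k} a u = (u ≡ 0ℚ × (∀ i → a i ≡ ¼)) ⊎ (5 ≤ k × u ≡ ½ × (∀ i → a i ≡ 0ℚ))

module ExtremalPoint {k : ℕ} {s : Fin k → Bool} {a : Fin k → ℚ} {u : ℚ}
                     (0≤a : ∀ i → 0ℚ ℚ.≤ a i) (extremal : IsExtremal (InT k) (point s a u)) where

  admissible : Admissible a u
  admissible = InT⇒admissible s (proj₁ extremal)

  0≤u : 0ℚ ℚ.≤ u
  0≤u = proj₁ admissible

  deficit-≤ : ∀ i → deficit (a i) ℚ.≤ 2ℚ * u
  deficit-≤ i = subst (ℚ._≤ 2ℚ * u) (ℚₚ.+-identityʳ _)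
                      (proj₂ admissible 1 (s≤s z≤n) (s≤s z≤n) (λ _ → i) (singleton-injective i))

  midpoint-trivial : ∀ s₁ s₂ {a₁ a₂ u₁ u₂} → (∀ i → 0ℚ ℚ.≤ a₁ i) → (∀ i → 0ℚ ℚ.≤ a₂ i) →
    Admissible a₁ u₁ → Admissible a₂ u₂ → point s a u ≈ₚ combo ½ (point s₁ a₁ u₁) (point s₂ a₂ u₂) →
    (∀ i → a₁ i ≡ a i) × u₁ ≡ u
  midpoint-trivial s₁ s₂ {a₁} {a₂} {u₁} {u₂} 0≤a₁ 0≤a₂ adm₁ adm₂ split =
    point-injective 0≤a₁ 0≤a (proj₁ (proj₂ extremal (point s₁ a₁ u₁) (point s₂ a₂ u₂) ½
                                                    (admissible⇒InT s₁ 0≤a₁ adm₁) (admissible⇒InT s₂ 0≤a₂ adm₂)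
                                                    (ℚₚ.positive⁻¹ ½) ½<1 split))

  perturb-magnitude : ∀ i {v⁺ v⁻} → 0ℚ ℚ.≤ v⁺ → 0ℚ ℚ.≤ v⁻ → a i ≡ ½ * v⁺ + (1ℚ - ½) * v⁻ →
    Admissible (updateAt a i (const v⁺)) u → Admissible (updateAt a i (const v⁻)) u → v⁺ ≡ a i
  perturb-magnitude i {v⁺} {v⁻} 0≤v⁺ 0≤v⁻ mid adm⁺ adm⁻ =
    trans (sym (updateAt-updates i a)) (proj₁ (midpoint-trivial s s 0≤a⁺ 0≤a⁻ adm⁺ adm⁻ split) i)
    where
    0≤a⁺ : ∀ j → 0ℚ ℚ.≤ updateAt a i (const v⁺) j
    0≤a⁺ = update-nonNeg i 0≤a 0≤v⁺
    0≤a⁻ : ∀ j → 0ℚ ℚ.≤ updateAt a i (const v⁻) j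
    0≤a⁻ = update-nonNeg i 0≤a 0≤v⁻
    split : point s a u ≈ₚ combo ½ (point s (updateAt a i (const v⁺)) u) (point s (updateAt a i (const v⁻)) u)
    split = point-combo s ½ _ _ u u (update-midpoint a i v⁺ v⁻ mid) (midpoint-self u)

  magnitude-≤¼ : ∀ i → a i ℚ.≤ ¼
  magnitude-≤¼ i = ℚₚ.≮⇒≥ λ ¼<a → ℚₚ.<-irrefl (sym (a≡¼ (ℚₚ.<⇒≤ ¼<a))) ¼<a
    where
    no-new-deficit : ¼ ℚ.≤ a i → ∀ {v} → ¼ ℚ.≤ v → ∀ j → deficit (updateAt a i (const v) j) ℚ.≤ deficit (a j)
    no-new-deficit ¼≤a {v} ¼≤v j with j Fin.≟ i
    ... | yes refl = ℚₚ.≤-reflexive (trans (cong deficit (updateAt-updates i a))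
                                           (trans (deficit-of-≥¼ ¼≤v) (sym (deficit-of-≥¼ ¼≤a))))
    ... | no  j≢i  = ℚₚ.≤-reflexive (cong deficit (updateAt-minimal j i a j≢i))
    a≡¼ : ¼ ℚ.≤ a i → a i ≡ ¼
    a≡¼ ¼≤a = reflection-fixed (perturb-magnitude i
      (ℚₚ.≤-trans (ℚₚ.nonNegative⁻¹ ¼) (reflection-≥ ¼≤a)) (ℚₚ.nonNegative⁻¹ ¼) (reflection-midpoint ¼ (a i))
      (Admissible-mono {a = a} {a′ = updateAt a i (const (a i + (a i - ¼)))}
                       (no-new-deficit ¼≤a (reflection-≥ ¼≤a)) admissible)
      (Admissible-mono {a = a} {a′ = updateAt a i (const ¼)} (no-new-deficit ¼≤a ℚₚ.≤-refl) admissible))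

  slack-≤½ : u ℚ.≤ ½
  slack-≤½ = ℚₚ.≮⇒≥ λ ½<u → ℚₚ.<-irrefl (sym (u≡½ (ℚₚ.<⇒≤ ½<u))) ½<u
    where
    u≡½ : ½ ℚ.≤ u → u ≡ ½
    u≡½ ½≤u = reflection-fixed (proj₂ (midpoint-trivial s s {u₁ = u + (u - ½)} {u₂ = ½} 0≤a 0≤a
      (admissible-of-slack-≥½ 0≤a (reflection-≥ ½≤u)) (admissible-of-slack-≥½ 0≤a ℚₚ.≤-refl)
      (point-combo s ½ a a (u + (u - ½)) ½ (midpoint-self ∘ a) (reflection-midpoint ½ u))))

  slack-≥½⇒magnitudes-zero : ½ ℚ.≤ u → ∀ i → a i ≡ 0ℚ
  slack-≥½⇒magnitudes-zero ½≤u i = reflection-fixed (perturb-magnitude i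
    0≤v⁺ ℚₚ.≤-refl (reflection-midpoint 0ℚ (a i))
    (admissible-of-slack-≥½ (update-nonNeg i 0≤a 0≤v⁺) ½≤u)
    (admissible-of-slack-≥½ (update-nonNeg i 0≤a ℚₚ.≤-refl) ½≤u))
    where
    0≤v⁺ : 0ℚ ℚ.≤ a i + (a i - 0ℚ)
    0≤v⁺ = reflection-≥ (0≤a i)

  slack-zero⇒magnitudes-¼ : u ≡ 0ℚ → ∀ i → a i ≡ ¼
  slack-zero⇒magnitudes-¼ u≡0 i = ℚₚ.≤-antisym (magnitude-≤¼ i) (≤-by-gap {¼} (0ℚ - deficit (a i)) gap≡ 0≤gap)
    where
    lemma : ∀ x → x - ¼ ≡ 0ℚ - (¼ - x)
    lemma = solve-∀ ℚ-ring
    gap≡ : a i - ¼ ≡ 0ℚ - deficit (a i)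
    gap≡ = trans (lemma (a i)) (cong (λ d → 0ℚ - d) (sym (deficit-of-≤¼ (magnitude-≤¼ i))))
    0≤gap : 0ℚ ℚ.≤ 0ℚ - deficit (a i)
    0≤gap = gap-nonNeg (subst (deficit (a i) ℚ.≤_) (cong (2ℚ *_) u≡0) (deficit-≤ i))

  -- Scaling all deficits by 1 ∓ m, together with the slack, splits the point.
  magnitudes-pos⇒slack-not-pos : (∀ i → 0ℚ ℚ.< a i) → ¬ (0ℚ ℚ.< u)
  magnitudes-pos⇒slack-not-pos 0<a 0<u = ℚₚ.<-irrefl (sym mu≡0) (*-pos 0<m 0<u)
    where
    m : ℚ
    m = foldr _⊓_ 1ℚ a
    0<m : 0ℚ ℚ.< m
    0<m = foldr-⊓-pos a (ℚₚ.positive⁻¹ 1ℚ) 0<a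
    a⁺ a⁻ : Fin k → ℚ
    a⁺ i = ¼ - (1ℚ - m) * (¼ - a i)
    a⁻ i = ¼ - (1ℚ + m) * (¼ - a i)
    0≤1-m : 0ℚ ℚ.≤ 1ℚ - m
    0≤1-m = gap-nonNeg (foldr-⊓-≤-init 1ℚ a)
    0≤1+m : 0ℚ ℚ.≤ 1ℚ + m
    0≤1+m = ℚₚ.+-mono-≤ (ℚₚ.nonNegative⁻¹ 1ℚ) (ℚₚ.<⇒≤ 0<m)
    0≤a⁺ : ∀ i → 0ℚ ℚ.≤ a⁺ i
    0≤a⁺ i = nonNeg-≡ (lemma m (a i))
                      (ℚₚ.+-mono-≤ (0≤a i) (*-nonNeg (ℚₚ.<⇒≤ 0<m) (gap-nonNeg (magnitude-≤¼ i))))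
      where lemma : ∀ m x → ¼ - (1ℚ - m) * (¼ - x) ≡ x + m * (¼ - x)
            lemma = solve-∀ ℚ-ring
    0≤a⁻ : ∀ i → 0ℚ ℚ.≤ a⁻ i
    0≤a⁻ i = nonNeg-≡ (lemma m (a i))
                      (ℚₚ.+-mono-≤ (gap-nonNeg (foldr-⊓-≤ 1ℚ a i))
                                   (*-nonNeg (ℚₚ.<⇒≤ 0<m) (ℚₚ.+-mono-≤ (ℚₚ.nonNegative⁻¹ ¾) (0≤a i))))
      where lemma : ∀ m x → ¼ - (1ℚ + m) * (¼ - x) ≡ (x - m) + m * (¾ + x)
            lemma = solve-∀ ℚ-ring
    split : point s a u ≈ₚ combo ½ (point s a⁺ ((1ℚ - m) * u)) (point s a⁻ ((1ℚ + m) * u))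
    split = point-combo s ½ a⁺ a⁻ ((1ℚ - m) * u) ((1ℚ + m) * u) (λ i → lemma m (a i)) (lemma′ m u)
      where lemma : ∀ m x → x ≡ ½ * (¼ - (1ℚ - m) * (¼ - x)) + (1ℚ - ½) * (¼ - (1ℚ + m) * (¼ - x))
            lemma = solve-∀ ℚ-ring
            lemma′ : ∀ m u → u ≡ ½ * ((1ℚ - m) * u) + (1ℚ - ½) * ((1ℚ + m) * u)
            lemma′ = solve-∀ ℚ-ring
    u⁺≡u : (1ℚ - m) * u ≡ u
    u⁺≡u = proj₂ (midpoint-trivial s s {a⁺} {a⁻} {(1ℚ - m) * u} {(1ℚ + m) * u} 0≤a⁺ 0≤a⁻
      (Admissible-scale {a = a} {a′ = a⁺} (1ℚ - m) 0≤1-m (deficit-scale 0≤1-m ∘ magnitude-≤¼) admissible)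
      (Admissible-scale {a = a} {a′ = a⁻} (1ℚ + m) 0≤1+m (deficit-scale 0≤1+m ∘ magnitude-≤¼) admissible)
      split)
    mu≡0 : m * u ≡ 0ℚ
    mu≡0 = trans (lemma m u) (trans (cong (λ v → u - v) u⁺≡u) (ℚₚ.+-inverseʳ u))
      where lemma : ∀ m u → m * u ≡ u - (1ℚ - m) * u
            lemma = solve-∀ ℚ-ring

  zero-magnitude : 0ℚ ℚ.< u → ∃ λ i → a i ≡ 0ℚ
  zero-magnitude 0<u = by-cases (Finₚ.any? (λ i → a i ℚₚ.≟ 0ℚ))
    where
    by-cases : Dec (∃ λ i → a i ≡ 0ℚ) → ∃ λ i → a i ≡ 0ℚ
    by-cases (yes found) = found
    by-cases (no  none) = ⊥-elim (magnitudes-pos⇒slack-not-pos pos 0<u)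
      where pos : ∀ i → 0ℚ ℚ.< a i
            pos i = [ id , (λ a≡0 → ⊥-elim (none (i , a≡0))) ]′ (pos-or-zero (0≤a i))

  module _ (i₀ : Fin k) (a≡0 : a i₀ ≡ 0ℚ) where

    AvoidingBound : ℚ → Set
    AvoidingBound c = ∀ t → 1 ≤ t → t ≤ 4 → (I : Fin t → Fin k) → Injective _≡_ _≡_ I → (∀ r → I r ≢ i₀) →
                      sumF (deficit ∘ a ∘ I) ℚ.≤ c

    deficit-at-i₀ : deficit (a i₀) ≡ ¼
    deficit-at-i₀ = trans (cong deficit a≡0) (deficit-of-≤¼ (ℚₚ.nonNegative⁻¹ ¼))

    avoiding-bound : ∀ t (I : Fin t → Fin k) → Injective _≡_ _≡_ I → (∀ r → I r ≢ i₀) → suc t ≤ 4 →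
      sumF (deficit ∘ a ∘ I) ℚ.≤ 2ℚ * u - ¼
    avoiding-bound t I I-inj avoid t<4 =
      ≤-by-gap _ (trans (lemma (2ℚ * u) ¼ (sumF (deficit ∘ a ∘ I)))
                        (cong (λ d → 2ℚ * u - (d + sumF (deficit ∘ a ∘ I))) (sym deficit-at-i₀)))
                 (gap-nonNeg (proj₂ admissible (suc t) (s≤s z≤n) t<4 (i₀ ∷ I) (injective-∷ I-inj avoid)))
      where lemma : ∀ U q S → U - q - S ≡ U - (q + S)
            lemma = solve-∀ ℚ-ring

    ¼≤2u : ¼ ℚ.≤ 2ℚ * u
    ¼≤2u = ≤-by-gap (2ℚ * u - ¼) refl
                    (avoiding-bound 0 (λ ()) (λ {x} → ⊥-elim (Finₚ.¬Fin0 x)) (λ ()) (s≤s z≤n))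

    flipped-admissible : ∀ {δ} → δ ℚ.≤ ¼ → δ ℚ.≤ 2ℚ * u → AvoidingBound (2ℚ * u - δ) →
      Admissible (updateAt a i₀ (const δ)) (u - ½ * δ)
    flipped-admissible {δ} δ≤¼ δ≤2u avoiding =
      nonNeg-≡ (lemma u δ) (*-nonNeg (ℚₚ.nonNegative⁻¹ ½) (gap-nonNeg δ≤2u)) ,
      λ t 1≤t t≤4 I I-inj →
        subst (_ ℚ.≤_) (sym (lemma′ u δ)) (by-cases t 1≤t t≤4 I I-inj (Finₚ.any? (λ r → I r Fin.≟ i₀)))
      where
      a′ : Fin k → ℚ
      a′ = updateAt a i₀ (const δ)
      lemma : ∀ u δ → u - ½ * δ ≡ ½ * (2ℚ * u - δ)
      lemma = solve-∀ ℚ-ring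
      lemma′ : ∀ u δ → 2ℚ * (u - ½ * δ) ≡ 2ℚ * u - δ
      lemma′ = solve-∀ ℚ-ring
      by-cases : ∀ t → 1 ≤ t → t ≤ 4 → (I : Fin t → Fin k) → Injective _≡_ _≡_ I →
        Dec (∃ λ r → I r ≡ i₀) → sumF (deficit ∘ a′ ∘ I) ℚ.≤ 2ℚ * u - δ
      by-cases t 1≤t t≤4 I I-inj (no ∌i₀) =
        subst (ℚ._≤ _) (sym (sumF-update-∌ deficit a i₀ δ I (λ r eq → ∌i₀ (r , eq))))
              (avoiding t 1≤t t≤4 I I-inj (λ r eq → ∌i₀ (r , eq)))
      by-cases t 1≤t t≤4 I I-inj (yes (r , Ir≡i₀)) =
        ≤-by-gap _ (trans (cong (λ X → 2ℚ * u - δ - X) exchange) (regroup (2ℚ * u) δ _))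
                   (gap-nonNeg (proj₂ admissible t 1≤t t≤4 I I-inj))
        where
        exchange : sumF (deficit ∘ a′ ∘ I) ≡ sumF (deficit ∘ a ∘ I) + ((¼ - δ) - ¼)
        exchange = subst₂ (λ d d′ → sumF (deficit ∘ a′ ∘ I) ≡ sumF (deficit ∘ a ∘ I) + (d′ - d))
                          deficit-at-i₀ (deficit-of-≤¼ δ≤¼)
                          (sumF-update-∋ deficit a i₀ δ I I-inj r Ir≡i₀)
        regroup : ∀ U δ S → U - δ - (S + ((¼ - δ) - ¼)) ≡ U - S
        regroup = solve-∀ ℚ-ring

    flip-impossible : ∀ δ → 0ℚ ℚ.< δ → δ ℚ.≤ ¼ → δ ℚ.≤ 2ℚ * u → AvoidingBound (2ℚ * u - δ) → ⊥
    flip-impossible δ 0<δ δ≤¼ δ≤2u avoiding = ℚₚ.<-irrefl (sym δ≡0) 0<δ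
      where
      a′ : Fin k → ℚ
      a′ = updateAt a i₀ (const δ)
      0≤a′ : ∀ i → 0ℚ ℚ.≤ a′ i
      0≤a′ = update-nonNeg i₀ 0≤a (ℚₚ.<⇒≤ 0<δ)
      flipped : Admissible a′ (u - ½ * δ)
      flipped = flipped-admissible δ≤¼ δ≤2u avoiding
      δ≡0 : δ ≡ 0ℚ
      δ≡0 = trans (sym (updateAt-updates i₀ a))
                  (trans (proj₁ (midpoint-trivial (updateAt s i₀ (const false)) (updateAt s i₀ (const true))
                                                  {a′} {a′} {u - ½ * δ} {u - ½ * δ} 0≤a′ 0≤a′ flipped flipped
                                                  (point-flip s a u i₀ δ a≡0)) i₀)
                         a≡0)

    zero-magnitude⇒5≤k : 5 ≤ k
    zero-magnitude⇒5≤k = ℕₚ.≰⇒> λ k≤4 →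
      flip-impossible ¼ (ℚₚ.positive⁻¹ ¼) ℚₚ.≤-refl ¼≤2u λ t _ _ I I-inj avoid →
        avoiding-bound t I I-inj avoid (ℕₚ.≤-trans (Finₚ.injective⇒≤ (injective-∷ I-inj avoid)) k≤4)

    -- Average the bounds for the four 4-sets made of i₀ and three indices of I.
    four-avoiding-bound : (I : Fin 4 → Fin k) → Injective _≡_ _≡_ I → (∀ r → I r ≢ i₀) →
      fromℕ 4 * sumF (deficit ∘ a ∘ I) - sumF (deficit ∘ a ∘ I) ℚ.≤ fromℕ 4 * (2ℚ * u - ¼)
    four-avoiding-bound I I-inj avoid =
      subst₂ ℚ._≤_ (trans (sumF-- (const S) (deficit ∘ a ∘ I)) (cong (_- S) (sumF-const 4 S)))
                   (sumF-const 4 (2ℚ * u - ¼))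
                   (sumF-mono-≤ three)
      where
      S : ℚ
      S = sumF (deficit ∘ a ∘ I)
      three : ∀ r → S - deficit (a (I r)) ℚ.≤ 2ℚ * u - ¼
      three r = subst (ℚ._≤ 2ℚ * u - ¼) drop
        (avoiding-bound 3 (I ∘ punchIn r) (λ eq → Finₚ.punchIn-injective r _ _ (I-inj eq)) (avoid ∘ punchIn r)
                        ℕₚ.≤-refl)
        where
        lemma : ∀ d R → R ≡ d + R - d
        lemma = solve-∀ ℚ-ring
        drop : sumF (deficit ∘ a ∘ I ∘ punchIn r) ≡ S - deficit (a (I r))
        drop = trans (lemma (deficit (a (I r))) _)
                     (cong (_- deficit (a (I r))) (sym (sumF-punchIn r (deficit ∘ a ∘ I))))

    avoiding-bound-≤½ : u ℚ.≤ ½ → AvoidingBound (2ℚ * u - (¼ - ½ * u))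
    avoiding-bound-≤½ u≤½ t _ t≤4 I I-inj avoid with t ℕₚ.≤? 3
    ... | yes t≤3 = ℚₚ.≤-trans (avoiding-bound t I I-inj avoid (s≤s t≤3))
                               (≤-by-gap (½ * u) (lemma u) (*-nonNeg (ℚₚ.nonNegative⁻¹ ½) 0≤u))
      where lemma : ∀ u → 2ℚ * u - (¼ - ½ * u) - (2ℚ * u - ¼) ≡ ½ * u
            lemma = solve-∀ ℚ-ring
    ... | no  t≰3 with ℕₚ.≤-antisym t≤4 (ℕₚ.≰⇒> t≰3)
    ... | refl = ≤-by-gap _ (lemma u (sumF (deficit ∘ a ∘ I)))
                   (ℚₚ.+-mono-≤ (*-nonNeg (ℚₚ.nonNegative⁻¹ (ℤ.+ 1 / 3))
                                          (gap-nonNeg (four-avoiding-bound I I-inj avoid)))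
                                (*-nonNeg (ℚₚ.nonNegative⁻¹ (ℤ.+ 1 / 6)) (gap-nonNeg u≤½)))
      where lemma : ∀ u S → 2ℚ * u - (¼ - ½ * u) - S
                            ≡ ℤ.+ 1 / 3 * ((1ℚ + (1ℚ + (1ℚ + (1ℚ + 0ℚ)))) * (2ℚ * u - ¼)
                                            - ((1ℚ + (1ℚ + (1ℚ + (1ℚ + 0ℚ)))) * S - S))
                              + ℤ.+ 1 / 6 * (½ - u)
            lemma = solve-∀ ℚ-ring

    zero-magnitude⇒½≤slack : ½ ℚ.≤ u
    zero-magnitude⇒½≤slack = ℚₚ.≮⇒≥ λ u<½ →
      flip-impossible (¼ - ½ * u) (0<δ u<½) δ≤¼ δ≤2u (avoiding-bound-≤½ (ℚₚ.<⇒≤ u<½))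
      where
      0<δ : u ℚ.< ½ → 0ℚ ℚ.< ¼ - ½ * u
      0<δ u<½ = subst (0ℚ ℚ.<_) (sym (lemma u)) (*-pos (ℚₚ.positive⁻¹ ½) (gap-pos u<½))
        where lemma : ∀ u → ¼ - ½ * u ≡ ½ * (½ - u)
              lemma = solve-∀ ℚ-ring
      δ≤¼ : ¼ - ½ * u ℚ.≤ ¼
      δ≤¼ = ≤-by-gap (½ * u) (lemma u) (*-nonNeg (ℚₚ.nonNegative⁻¹ ½) 0≤u)
        where lemma : ∀ u → ¼ - (¼ - ½ * u) ≡ ½ * u
              lemma = solve-∀ ℚ-ring
      δ≤2u : ¼ - ½ * u ℚ.≤ 2ℚ * u
      δ≤2u = ≤-by-gap (2ℚ * u - ¼ + ½ * u) (lemma u)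
                      (ℚₚ.+-mono-≤ (gap-nonNeg ¼≤2u) (*-nonNeg (ℚₚ.nonNegative⁻¹ ½) 0≤u))
        where lemma : ∀ u → 2ℚ * u - (¼ - ½ * u) ≡ 2ℚ * u - ¼ + ½ * u
              lemma = solve-∀ ℚ-ring

  classification-with-zero : ∀ i₀ → a i₀ ≡ 0ℚ → SpecialCoordinates a u
  classification-with-zero i₀ a≡0 =
    inj₂ (zero-magnitude⇒5≤k i₀ a≡0 , ℚₚ.≤-antisym slack-≤½ ½≤u , slack-≥½⇒magnitudes-zero ½≤u)
    where ½≤u : ½ ℚ.≤ u
          ½≤u = zero-magnitude⇒½≤slack i₀ a≡0

  classification : SpecialCoordinates a u
  classification = [ (λ 0<u → let (i₀ , a≡0) = zero-magnitude 0<u in classification-with-zero i₀ a≡0)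
                   , (λ u≡0 → inj₁ (u≡0 , slack-zero⇒magnitudes-¼ u≡0)) ]′ (pos-or-zero 0≤u)

extremal⇒special : ∀ k (p : Point k) → IsExtremal (InT k) p →
  (∃ λ (J : Subset k) → p ≈ₚ σ J (Pt k)) ⊎ (5 ≤ k × p ≈ₚ Qt k)
extremal⇒special k p p-extremal =
  conclude (ExtremalPoint.classification {k} {s} {a} {u} (magnitudes-nonNeg p) coordinates-extremal)
  where
  s : Fin k → Bool
  s = signs p
  a : Fin k → ℚ
  a = magnitudes p
  u : ℚ
  u = slack p
  coordinates-extremal : IsExtremal (InT k) (point s a u)
  coordinates-extremal = IsExtremal-resp (point-coordinates p) p-extremal
  conclude : SpecialCoordinates a u → (∃ λ (J : Subset k) → p ≈ₚ σ J (Pt k)) ⊎ (5 ≤ k × p ≈ₚ Qt k)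
  conclude (inj₁ (u≡0 , a≡¼)) = inj₁ (J , (begin
    p                                               ≈⟨ point-coordinates p ⟩
    point s a u                                     ≈⟨ point-cong signs≡ a≡¼ u≡0 ⟩
    point (λ i → lookup J i xor false) (const ¼) 0ℚ ≈⟨ σ-point J (const false) (const ¼) 0ℚ ⟨
    σ J (point (const false) (const ¼) 0ℚ)          ≈⟨ σ-cong J (Pt-point k) ⟨
    σ J (Pt k)                                      ∎))
    where
    open ≈ₚ-Reasoning k
    J : Subset k
    J = Vec.tabulate s
    J≗s : ∀ i → lookup J i ≡ s i
    J≗s = VecP.lookup∘tabulate s
    signs≡ : ∀ i → s i ≡ lookup J i xor false
    signs≡ i = sym (trans (Boolₚ.xor-identityʳ (lookup J i)) (J≗s i))
  conclude (inj₂ (5≤k , u≡½ , a≡0)) = inj₂ (5≤k , (begin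
    p                                     ≈⟨ point-coordinates p ⟩
    point s a u                           ≈⟨ point-cong (λ _ → refl) a≡0 u≡½ ⟩
    point s (const 0ℚ) ½                  ≈⟨ point-zero-magnitudes s (const false) ½ ⟩
    point (const false) (const 0ℚ) ½      ≈⟨ Qt-point k ⟨
    Qt k                                  ∎))
    where open ≈ₚ-Reasoning k

proposition5p2 : (k : ℕ) → 1 ≤ k → (p : Point k) →
    (IsExtremal (InT k) p →
      (∃ λ (J : Subset k) → p ≈ₚ σ J (Pt k)) ⊎ (5 ≤ k × p ≈ₚ Qt k))
    × ((∃ λ (J : Subset k) → p ≈ₚ σ J (Pt k)) ⊎ (5 ≤ k × p ≈ₚ Qt k) →
      IsExtremal (InT k) p)
proposition5p2 k _ p = extremal⇒special k p , special⇒extremal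
  where
  special⇒extremal : (∃ λ (J : Subset k) → p ≈ₚ σ J (Pt k)) ⊎ (5 ≤ k × p ≈ₚ Qt k) → IsExtremal (InT k) p
  special⇒extremal (inj₁ (J , p≈σP)) = IsExtremal-resp (≈ₚ-sym p≈σP) (extremal-σ J (P-extremal k))
  special⇒extremal (inj₂ (5≤k , p≈Q)) = IsExtremal-resp (≈ₚ-sym p≈Q) (Q-extremal 5≤k)
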